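{- Let $G$ be a finite abelian group of order $n$, let $H$ be a cyclic subgroup of $G$ of order $d$, let $\rho:G\to H$ be an epimorphism (extended linearly to $\mathbb{Z}[G]\to\mathbb{Z}[H]$), and let $D$ be a subset of $G$. Then for each generator $\widehat{\chi}$ of the character group $\widehat{H}$, one has $\widehat{\chi}(\rho(D))=\sum_{x\in B_{d,1}}c_x x$, where each $c_x$ is an integer with $|c_x|\leq 2^{t-1}\frac{n}{d}$ and $t$ is the number of distinct prime divisors of $d$.
   Context: $\zeta_n=e^{2\pi i/n}$. Writing $d=\prod_{i=1}^{t}p_i^{a_i}$ (prime factorization), $B_{d,1}=\big\{\prod_{i=1}^{t}\zeta_{p_i}^{k_i}\zeta_{p_i^{a_i}}^{l_i}: 0\leq k_i\leq p_i-2,\ 0\leq l_i\leq p_i^{a_i-1}-1\big\}$, which is an integral basis of $\mathbb{Q}(\zeta_d)$ over $\mathbb{Q}$. Characters are extended linearly to group rings, and a subset is identified with the sum of its elements in $\mathbb{Z}[G]$. -}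

module Defs where

open import Level using (0ℓ)
open import Data.Nat as ℕ using (ℕ; zero; suc; _≤_; _<_; _∸_)
open import Data.Nat.Primality using (Prime)
open import Data.Integer as ℤ using (ℤ; +_; -[1+_])
open import Data.Fin using (Fin; toℕ)
open import Data.Fin.Subset using (Subset; _∈_)
open import Data.Fin.Subset.Properties using (_∈?_)
open import Data.List using (List; []; _∷_; map; concatMap; allFin; foldr)
open import Data.List.Relation.Unary.All using (All)
open import Data.List.Relation.Unary.AllPairs using (AllPairs)
open import Data.Product using (Σ; ∃; _×_; _,_; proj₁; proj₂)
open import Data.Sum using (_⊎_)
open import Data.Unit using (⊤; tt)
open import Relation.Nullary using (¬_; yes; no)
open import Relation.Binary.PropositionalEquality using (_≡_; _≢_)
open import Algebra.Core using (Op₁; Op₂)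
open import Algebra.Structures using (IsAbelianGroup)
open import Algebra.Bundles using (CommutativeRing)

-- A finite abelian group of order n, realised on the carrier Fin n
-- (every finite abelian group of order n is isomorphic to such a one).

record FinAbGroup (n : ℕ) : Set where
  field
    _∙_            : Op₂ (Fin n)
    ε              : Fin n
    _⁻¹            : Op₁ (Fin n)
    isAbelianGroup : IsAbelianGroup _≡_ _∙_ ε _⁻¹

module GroupDefs {n : ℕ} (G : FinAbGroup n) where
  open FinAbGroup G

  gpow : Fin n → ℕ → Fin n
  gpow x zero    = ε
  gpow x (suc j) = x ∙ gpow x j

  HasOrder : Fin n → ℕ → Set
  HasOrder h d = (0 < d) × (gpow h d ≡ ε) × (∀ e → 0 < e → e < d → gpow h e ≢ ε)

  In⟨_⟩ : Fin n → Fin n → Set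
  In⟨ h ⟩ x = ∃ λ j → x ≡ gpow h j

  IsEpiOnto : Fin n → (Fin n → Fin n) → Set
  IsEpiOnto h ρ =
    (∀ x y → ρ (x ∙ y) ≡ ρ x ∙ ρ y) ×
    (∀ x → In⟨ h ⟩ (ρ x)) ×
    (∀ y → In⟨ h ⟩ y → ∃ λ x → ρ x ≡ y)

-- Ring-level notions (for a commutative ring K standing in for ℂ)

module RingDefs (K : CommutativeRing 0ℓ 0ℓ) where
  open CommutativeRing K

  natK : ℕ → Carrier
  natK zero    = 0#
  natK (suc m) = 1# + natK m

  intK : ℤ → Carrier
  intK (+ m)      = natK m
  intK -[1+ m ]   = - natK (suc m)

  pow : Carrier → ℕ → Carrier
  pow x zero    = 1#
  pow x (suc m) = x * pow x m

  sumK : List Carrier → Carrier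
  sumK = foldr _+_ 0#

  IsIntegralDomain : Set
  IsIntegralDomain = ∀ x y → x * y ≈ 0# → (x ≈ 0#) ⊎ (y ≈ 0#)

  CharZero : Set
  CharZero = ∀ m → ¬ (natK (suc m) ≈ 0#)

  IsPrimitiveRoot : ℕ → Carrier → Set
  IsPrimitiveRoot d ζ = (pow ζ d ≈ 1#) × (∀ e → 0 < e → e < d → ¬ (pow ζ e ≈ 1#))

module CharDefs {n : ℕ} (G : FinAbGroup n) (K : CommutativeRing 0ℓ 0ℓ) where
  open FinAbGroup G
  open GroupDefs G
  open CommutativeRing K renaming (Carrier to K₀)
  open RingDefs K

  IsCharOf : Fin n → (Fin n → K₀) → Set
  IsCharOf h χ =
    (χ ε ≈ 1#) × (∀ x y → In⟨ h ⟩ x → In⟨ h ⟩ y → χ (x ∙ y) ≈ χ x * χ y)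

  IsGeneratorOfDual : Fin n → (Fin n → K₀) → Set
  IsGeneratorOfDual h χ =
    IsCharOf h χ ×
    (∀ ψ → IsCharOf h ψ → ∃ λ m → ∀ x → In⟨ h ⟩ x → ψ x ≈ pow (χ x) m)

  -- χ(ρ(D)) = Σ_{g ∈ D} χ(ρ g)   (linear extension to group rings)
  charOfImage : (Fin n → K₀) → (Fin n → Fin n) → Subset n → K₀
  charOfImage χ ρ D = sumK (map term (allFin n))
    where
    term : Fin n → K₀
    term g with g ∈? D
    ... | yes _ = χ (ρ g)
    ... | no  _ = 0#

ppow : ℕ × ℕ → ℕ
ppow (p , a) = p ℕ.^ a

prodPP : List (ℕ × ℕ) → ℕ
prodPP []       = 1
prodPP (q ∷ fs) = ppow q ℕ.* prodPP fs

IsPrimeFactorisation : ℕ → List (ℕ × ℕ) → Set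
IsPrimeFactorisation d fs =
  All (λ q → Prime (proj₁ q) × 1 ≤ proj₂ q) fs ×
  AllPairs (λ q r → proj₁ q ≢ proj₁ r) fs ×
  prodPP fs ≡ d

-- index set of B_{d,1}: tuples (k_i, l_i) with 0 ≤ k_i ≤ p_i-2, 0 ≤ l_i ≤ p_i^(a_i-1)-1
Idx : List (ℕ × ℕ) → Set
Idx []             = ⊤
Idx ((p , a) ∷ fs) = Fin (p ∸ 1) × Fin (p ℕ.^ (a ∸ 1)) × Idx fs

allIdx : (fs : List (ℕ × ℕ)) → List (Idx fs)
allIdx [] = tt ∷ []
allIdx ((p , a) ∷ fs) =
  concatMap (λ k → concatMap (λ l → map (λ r → k , l , r) (allIdx fs))
                              (allFin (p ℕ.^ (a ∸ 1))))
            (allFin (p ∸ 1))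

-- exponent e with ∏ ζ_{p_i}^{k_i} ζ_{p_i^{a_i}}^{l_i} = ζ_d^e, using
-- ζ_{p^a} = ζ_d^{d/p^a} and ζ_p = ζ_d^{d/p} = ζ_d^{p^(a-1)·d/p^a};
-- `pre` is the product of the prime powers already processed.
bexp : (fs : List (ℕ × ℕ)) → ℕ → Idx fs → ℕ
bexp [] pre tt = 0
bexp ((p , a) ∷ fs) pre (k , l , r) =
  (toℕ k ℕ.* p ℕ.^ (a ∸ 1) ℕ.+ toℕ l) ℕ.* (pre ℕ.* prodPP fs)
  ℕ.+ bexp fs (pre ℕ.* p ℕ.^ a) r

basisElt : (K : CommutativeRing 0ℓ 0ℓ) → CommutativeRing.Carrier K →
           (fs : List (ℕ × ℕ)) → Idx fs → CommutativeRing.Carrier K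
basisElt K ζ fs i = RingDefs.pow K ζ (bexp fs 1 i)

combB : (K : CommutativeRing 0ℓ 0ℓ) → CommutativeRing.Carrier K →
        (fs : List (ℕ × ℕ)) → (Idx fs → ℤ) → CommutativeRing.Carrier K
combB K ζ fs c =
  RingDefs.sumK K (map (λ i → CommutativeRing._*_ K (RingDefs.intK K (c i)) (basisElt K ζ fs i))
                       (allIdx fs))

{-# OPTIONS --safe #-}
-- Every value χ̂(ρ(g)) is a power ζ^r of the primitive d-th root ζ, and r determines ρ(g);
-- hence χ̂(ρ(D)) = Σ_{r<d} m_r ζ^r with every multiplicity m_r at most F = |ker ρ| = n/d.
-- Such a power sum is rewritten in B_{d,1} one prime power q = p^a of d at a time: the
-- Chinese remainder theorem writes ζ^r = ω^Y η^Z with ω, η primitive of coprime orders q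
-- and d/q, and 1 + w + ⋯ + w^(p-1) = 0 for w = ω^(p^(a-1)) removes the exponents
-- Y ≥ (p-1)p^(a-1), replacing each coefficient by a difference of two old ones. Differences
-- of counts in [0, F] lie in [-F, F], and each further prime at most doubles the bound,
-- whence 2^(t-1) F.
module Submission where

open import Defs
open import Level using (0ℓ)
open import Algebra.Bundles using (CommutativeSemiring; CommutativeRing; Group)
open import Algebra.Structures using (IsAbelianGroup)
open import Data.Bool as Bool using (if_then_else_)
open import Data.Empty using (⊥; ⊥-elim)
open import Data.Fin as Fin using (Fin; toℕ)
import Data.Fin.Properties as Fin
open import Data.Fin.Subset using (Subset)
open import Data.Fin.Subset.Properties using (_∈?_)
open import Data.Integer as ℤ using (ℤ; +_; ∣_∣)
import Data.Integer.Properties as ℤ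
open import Data.List as List using (List; []; _∷_; length; map; allFin; concatMap; _++_)
import Data.List.Properties as List
open import Data.List.Relation.Unary.All using (All; []; _∷_)
open import Data.List.Relation.Unary.AllPairs using (AllPairs; []; _∷_)
open import Data.Maybe using (nothing)
open import Data.Nat as ℕ using (ℕ; zero; suc; _≤_; _<_; _∸_; z≤n; s≤s)
import Data.Nat.Properties as ℕ
open import Data.Nat.Coprimality as Coprime using (Coprime; coprime-Bézout; coprime-divisor)
open import Data.Nat.Divisibility using (_∣0; ∣-refl; ∣-trans; ∣1⇒≡1; divides)
open import Data.Nat.DivMod using (_%_; _/_; m≡m%n+[m/n]*n; m%n<n)
open import Data.Nat.GCD using (module Bézout)
open import Data.Nat.Primality using (Prime; prime⇒irreducible; prime⇒nonZero; prime⇒nonTrivial)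
import Data.Nat.Solver
open import Data.Product using (Σ; ∃; ∃₂; _×_; _,_; proj₁; proj₂)
open import Data.Sum using (inj₁; inj₂)
open import Data.Unit using (tt)
open import Relation.Binary using (tri<; tri≈; tri>)
open import Relation.Binary.PropositionalEquality as ≡ using (_≡_; _≢_)
open import Relation.Nullary using (Dec; does; yes; no; ¬_)
open import Tactic.RingSolver.Core.AlmostCommutativeRing using (fromCommutativeRing)

module ℕSolver = Data.Nat.Solver.+-*-Solver

module RangeSums (R : CommutativeSemiring 0ℓ 0ℓ) where
  open CommutativeSemiring R renaming (Carrier to C)
  open import Algebra.Properties.CommutativeMonoid.Sum +-commutativeMonoid public
    using (sum; sum-syntax; sum-cong-≋; ∑-distrib-+; ∑-comm; ∑-permute; sum-init-last; sum-replicate-zero)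
  open import Algebra.Properties.Semiring.Sum semiring public
    using (*-distribˡ-sum; *-distribʳ-sum)
  open import Relation.Binary.Reasoning.Setoid setoid

  infixl 10 sumℕ
  sumℕ : ℕ → (ℕ → C) → C
  sumℕ n f = ∑[ i < n ] f (toℕ i)

  syntax sumℕ n (λ r → f) = ∑ℕ[ r < n ] f

  -- Defined through does, so that when (suc k ℕ.≟ suc r) v reduces to when (k ℕ.≟ r) v.
  when : {A : Set} → Dec A → C → C
  when a v = if does a then v else 0#

  when-cong : ∀ {A B : Set} (a : Dec A) (b : Dec B) {v} → (A → B) → (B → A) → when a v ≈ when b v
  when-cong (yes _) (yes _) _   _   = refl
  when-cong (no _)  (no _)  _   _   = refl
  when-cong (yes a) (no ¬b) a→b _   = ⊥-elim (¬b (a→b a))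
  when-cong (no ¬a) (yes b) _   b→a = ⊥-elim (¬a (b→a b))

  when-¬ : ∀ {A : Set} (a : Dec A) {v} → ¬ A → when a v ≈ 0#
  when-¬ (yes a) ¬a = ⊥-elim (¬a a)
  when-¬ (no _)  ¬a = refl

  sum-zero : ∀ {n} {f : Fin n → C} → (∀ i → f i ≈ 0#) → sum f ≈ 0#
  sum-zero {n} f≈0 = trans (sum-cong-≋ f≈0) (sum-replicate-zero n)

  sumℕ-split : ∀ a b (g : ℕ → C) → ∑ℕ[ r < a ℕ.+ b ] g r ≈ ∑ℕ[ r < a ] g r + ∑ℕ[ j < b ] g (a ℕ.+ j)
  sumℕ-split zero    b g = sym (+-identityˡ _)
  sumℕ-split (suc a) b g = trans (+-congˡ (sumℕ-split a b (λ r → g (suc r)))) (sym (+-assoc _ _ _))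

  sumℕ-blocks : ∀ a b (g : ℕ → C) →
                ∑ℕ[ r < a ℕ.* b ] g r ≈ ∑ℕ[ k < a ] ∑ℕ[ l < b ] g (k ℕ.* b ℕ.+ l)
  sumℕ-blocks zero    b g = refl
  sumℕ-blocks (suc a) b g = begin
    ∑ℕ[ r < b ℕ.+ a ℕ.* b ] g r                              ≈⟨ sumℕ-split b (a ℕ.* b) g ⟩
    ∑ℕ[ l < b ] g l + ∑ℕ[ j < a ℕ.* b ] g (b ℕ.+ j)           ≈⟨ +-congˡ (sumℕ-blocks a b (λ j → g (b ℕ.+ j))) ⟩
    ∑ℕ[ l < b ] g l + ∑ℕ[ k < a ] ∑ℕ[ l < b ] g (b ℕ.+ (k ℕ.* b ℕ.+ l))
      ≡⟨ ≡.cong (λ t → ∑ℕ[ l < b ] g l + t)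
           (sum-cong-≗ {a} (λ k → sum-cong-≗ {b} (λ l → ≡.cong g (≡.sym (ℕ.+-assoc b _ (toℕ l)))))) ⟩
    ∑ℕ[ k < suc a ] ∑ℕ[ l < b ] g (k ℕ.* b ℕ.+ l)              ∎
    where open import Algebra.Properties.Monoid.Sum +-monoid using (sum-cong-≗)

  sumℕ-last : ∀ n (g : ℕ → C) → ∑ℕ[ r < suc n ] g r ≈ ∑ℕ[ r < n ] g r + g n
  sumℕ-last n g = trans (sum-init-last (λ i → g (toℕ i)))
    (+-cong (sum-cong-≋ {n} (λ i → reflexive (≡.cong g (Fin.toℕ-inject₁ i))))
            (reflexive (≡.cong g (Fin.toℕ-fromℕ n))))

  sumℕ-when-≡ : ∀ {n k} (g : ℕ → C) → k < n → ∑ℕ[ r < n ] when (k ℕ.≟ r) (g r) ≈ g k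
  sumℕ-when-≡ {suc n} {zero}  g _         =
    trans (+-congˡ (sum-zero {n} (λ _ → refl))) (+-identityʳ (g 0))
  sumℕ-when-≡ {suc n} {suc k} g (s≤s k<n) =
    trans (+-identityˡ _) (sumℕ-when-≡ (λ r → g (suc r)) k<n)

  sum-fibres : ∀ {N} d (e : Fin N → ℕ) → (∀ x → e x < d) → (f : Fin N → ℕ → C) →
               ∑[ x < N ] f x (e x) ≈ ∑ℕ[ r < d ] ∑[ x < N ] when (e x ℕ.≟ r) (f x r)
  sum-fibres {N} d e e<d f = begin
    ∑[ x < N ] f x (e x)                                 ≈⟨ sum-cong-≋ (λ x → sym (sumℕ-when-≡ (f x) (e<d x))) ⟩
    ∑[ x < N ] ∑ℕ[ r < d ] when (e x ℕ.≟ r) (f x r)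
      ≈⟨ ∑-comm {N} {d} (λ x i → when (e x ℕ.≟ toℕ i) (f x (toℕ i))) ⟩
    ∑ℕ[ r < d ] ∑[ x < N ] when (e x ℕ.≟ r) (f x r)       ∎

module Counting where
  open RangeSums ℕ.+-*-commutativeSemiring public

  sum-mono-≤ : ∀ {n} {f g : Fin n → ℕ} → (∀ i → f i ≤ g i) → sum f ≤ sum g
  sum-mono-≤ {zero}  _   = z≤n
  sum-mono-≤ {suc n} f≤g = ℕ.+-mono-≤ (f≤g Fin.zero) (sum-mono-≤ (λ i → f≤g (Fin.suc i)))

  sum-const : ∀ n c → ∑[ i < n ] c ≡ n ℕ.* c
  sum-const zero    c = ≡.refl
  sum-const (suc n) c = ≡.cong (c ℕ.+_) (sum-const n c)

  when-≢0 : ∀ {A : Set} (a : Dec A) v → when a v ≢ 0 → A × v ≢ 0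
  when-≢0 (yes a) v v≢0 = a , v≢0
  when-≢0 (no _)  v 0≢0 = ⊥-elim (0≢0 ≡.refl)

  when-≤ : ∀ {A : Set} (a : Dec A) v → when a v ≤ v
  when-≤ (yes _) v = ℕ.≤-refl
  when-≤ (no _)  v = z≤n

  when-mono : ∀ {A B : Set} (a : Dec A) (b : Dec B) → (A → B) → ∀ {v w} → v ≤ w → when a v ≤ when b w
  when-mono (yes _) (yes _) _   v≤w = v≤w
  when-mono (yes a) (no ¬b) a→b _   = ⊥-elim (¬b (a→b a))
  when-mono (no _)  _       _   _   = z≤n

  fibreWeight : ∀ {N} → (Fin N → ℕ) → (Fin N → ℕ) → ℕ → ℕ
  fibreWeight key w r = ∑[ x < _ ] when (key x ℕ.≟ r) (w x)

  sum-≤-singleSupport : ∀ {n F} (f : Fin n → ℕ) → (∀ i j → f i ≢ 0 → f j ≢ 0 → i ≡ j) →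
                        (∀ i → f i ≤ F) → sum f ≤ F
  sum-≤-singleSupport {zero}  f single f≤F = z≤n
  sum-≤-singleSupport {suc n} f single f≤F with f Fin.zero ℕ.≟ 0
  ... | yes f₀≡0 = ℕ.≤-trans (ℕ.≤-reflexive (≡.cong (ℕ._+ sum (λ i → f (Fin.suc i))) f₀≡0))
                     (sum-≤-singleSupport (λ i → f (Fin.suc i))
                        (λ i j fi fj → Fin.suc-injective (single _ _ fi fj)) (λ i → f≤F (Fin.suc i)))
  ... | no  f₀≢0 = ℕ.≤-trans (ℕ.≤-reflexive (≡.trans (≡.cong (f Fin.zero ℕ.+_) rest≡0) (ℕ.+-identityʳ _)))
                     (f≤F Fin.zero)
    where
    vanish : ∀ i → f (Fin.suc i) ≡ 0
    vanish i with f (Fin.suc i) ℕ.≟ 0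
    ... | yes fi≡0 = fi≡0
    ... | no  fi≢0 with single Fin.zero (Fin.suc i) f₀≢0 fi≢0
    ... | ()
    rest≡0 : sum (λ i → f (Fin.suc i)) ≡ 0
    rest≡0 = sum-zero {n} vanish

coprime⇒bézout-mod : ∀ q d′ → Coprime q d′ →
                     ∃₂ λ a b → ∃ λ k → a ℕ.* d′ ℕ.+ b ℕ.* q ≡ 1 ℕ.+ k ℕ.* (q ℕ.* d′)
coprime⇒bézout-mod zero     d′       cop with cop (d′ ∣0 , ∣-refl)
... | ≡.refl = 1 , 0 , 0 , ≡.refl
coprime⇒bézout-mod (suc q₀) zero     cop with cop (∣-refl , suc q₀ ∣0)
... | ≡.refl = 0 , 1 , 0 , ≡.refl
coprime⇒bézout-mod (suc q₀) (suc d₀) cop with coprime-Bézout cop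
... | Bézout.+- x y 1+yd≡xq = y ℕ.* q₀ , x , y , (begin
  y ℕ.* q₀ ℕ.* suc d₀ ℕ.+ x ℕ.* suc q₀          ≡⟨ ≡.cong (y ℕ.* q₀ ℕ.* suc d₀ ℕ.+_) (≡.sym 1+yd≡xq) ⟩
  y ℕ.* q₀ ℕ.* suc d₀ ℕ.+ (1 ℕ.+ y ℕ.* suc d₀)  ≡⟨ ℕSolver.solve 3 (λ y q d →
      y :* q :* d :+ (con 1 :+ y :* d) := con 1 :+ y :* ((con 1 :+ q) :* d)) ≡.refl y q₀ (suc d₀) ⟩
  1 ℕ.+ y ℕ.* (suc q₀ ℕ.* suc d₀)               ∎)
  where open ≡.≡-Reasoning
        open ℕSolver using (_:+_; _:*_; _:=_; con)
... | Bézout.-+ x y 1+xq≡yd = y , x ℕ.* d₀ , x , (begin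
  y ℕ.* suc d₀ ℕ.+ x ℕ.* d₀ ℕ.* suc q₀          ≡⟨ ≡.cong (ℕ._+ x ℕ.* d₀ ℕ.* suc q₀) (≡.sym 1+xq≡yd) ⟩
  1 ℕ.+ x ℕ.* suc q₀ ℕ.+ x ℕ.* d₀ ℕ.* suc q₀    ≡⟨ ℕSolver.solve 3 (λ x q d →
      con 1 :+ x :* q :+ x :* d :* q := con 1 :+ x :* (q :* (con 1 :+ d))) ≡.refl x (suc q₀) d₀ ⟩
  1 ℕ.+ x ℕ.* (suc q₀ ℕ.* suc d₀)               ∎)
  where open ≡.≡-Reasoning
        open ℕSolver using (_:+_; _:*_; _:=_; con)

coprime-*ʳ : ∀ {a b c} → Coprime a b → Coprime a c → Coprime a (b ℕ.* c)
coprime-*ʳ {a} {b} {c} a⊥b a⊥c {i} (i∣a , i∣bc) = a⊥c (i∣a , coprime-divisor i⊥b i∣bc)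
  where
  i⊥b : Coprime i b
  i⊥b (j∣i , j∣b) = a⊥b (∣-trans j∣i i∣a , j∣b)

coprime-1ʳ : ∀ {a} → Coprime a 1
coprime-1ʳ (_ , i∣1) = ∣1⇒≡1 i∣1

coprime-^ʳ : ∀ {a b} → Coprime a b → ∀ k → Coprime a (b ℕ.^ k)
coprime-^ʳ a⊥b zero    = coprime-1ʳ
coprime-^ʳ a⊥b (suc k) = coprime-*ʳ a⊥b (coprime-^ʳ a⊥b k)

distinctPrimes-coprime : ∀ {p p′} → Prime p → Prime p′ → p ≢ p′ → Coprime p p′
distinctPrimes-coprime p-prime p′-prime p≢p′ (i∣p , i∣p′)
  with prime⇒irreducible p-prime i∣p | prime⇒irreducible p′-prime i∣p′
... | inj₁ i≡1 | _        = i≡1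
... | inj₂ _   | inj₁ i≡1 = i≡1
... | inj₂ i≡p | inj₂ i≡p′ = ⊥-elim (p≢p′ (≡.trans (≡.sym i≡p) i≡p′))

PrimePower : ℕ × ℕ → Set
PrimePower q = Prime (proj₁ q) × 1 ≤ proj₂ q

prime-coprime-prodPP : ∀ {p} fs → Prime p → All PrimePower fs → All (λ q → p ≢ proj₁ q) fs → Coprime p (prodPP fs)
prime-coprime-prodPP []               p-prime []                   []            = coprime-1ʳ
prime-coprime-prodPP ((p′ , a) ∷ fs) p-prime ((p′-prime , _) ∷ pps) (p≢p′ ∷ p∉fs) =
  coprime-*ʳ (coprime-^ʳ (distinctPrimes-coprime p-prime p′-prime p≢p′) a) (prime-coprime-prodPP fs p-prime pps p∉fs)

prodPP-positive : ∀ fs → All PrimePower fs → 0 < prodPP fs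
prodPP-positive []             []                  = s≤s z≤n
prodPP-positive ((p , a) ∷ fs) ((p-prime , _) ∷ pps) =
  ℕ.*-mono-< (ℕ.m^n>0 p a) (prodPP-positive fs pps)
  where
  instance
    p≢0 : ℕ.NonZero p
    p≢0 = prime⇒nonZero p-prime

bexp-scale : ∀ fs pre i → bexp fs pre i ≡ pre ℕ.* bexp fs 1 i
bexp-scale []             pre tt          = ≡.sym (ℕ.*-zeroʳ pre)
bexp-scale ((p , a) ∷ fs) pre (k , l , i) = begin
  E ℕ.* (pre ℕ.* d′) ℕ.+ bexp fs (pre ℕ.* q) i
    ≡⟨ ≡.cong (E ℕ.* (pre ℕ.* d′) ℕ.+_) (bexp-scale fs (pre ℕ.* q) i) ⟩
  E ℕ.* (pre ℕ.* d′) ℕ.+ pre ℕ.* q ℕ.* bexp fs 1 i          ≡⟨ ℕSolver.solve 5 (λ e pr d q b →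
      e :* (pr :* d) :+ pr :* q :* b := pr :* (e :* (con 1 :* d) :+ con 1 :* q :* b))
      ≡.refl E pre d′ q (bexp fs 1 i) ⟩
  pre ℕ.* (E ℕ.* (1 ℕ.* d′) ℕ.+ 1 ℕ.* q ℕ.* bexp fs 1 i)
    ≡⟨ ≡.cong (λ t → pre ℕ.* (E ℕ.* (1 ℕ.* d′) ℕ.+ t)) (bexp-scale fs (1 ℕ.* q) i) ⟨
  pre ℕ.* bexp ((p , a) ∷ fs) 1 (k , l , i)                ∎
  where
  open ≡.≡-Reasoning
  open ℕSolver using (_:+_; _:*_; _:=_; con)
  E d′ q : ℕ
  E  = toℕ k ℕ.* p ℕ.^ (a ∸ 1) ℕ.+ toℕ l
  d′ = prodPP fs
  q  = p ℕ.^ a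

-- The bound satisfied by the coefficients once t primes of d have been eliminated.
CoeffBound : ℕ → ℕ → ℤ → Set
CoeffBound zero    F (+ k)      = k ≤ F
CoeffBound zero    F ℤ.-[1+ _ ] = ⊥
CoeffBound (suc t) F v          = ∣ v ∣ ≤ 2 ℕ.^ t ℕ.* F

CoeffBound-- : ∀ t {F a b} → CoeffBound t F a → CoeffBound t F b → CoeffBound (suc t) F (a ℤ.- b)
CoeffBound-- zero    {F} {+ k} {+ l} k≤F l≤F = begin
  ∣ + k ℤ.- + l ∣   ≡⟨ ≡.cong ∣_∣ (ℤ.[+m]-[+n]≡m⊖n k l) ⟩
  ∣ k ℤ.⊖ l ∣       ≤⟨ ℤ.∣m⊝n∣≤m⊔n k l ⟩
  k ℕ.⊔ l           ≤⟨ ℕ.⊔-lub k≤F l≤F ⟩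
  F                 ≡⟨ ℕ.*-identityˡ F ⟨
  1 ℕ.* F           ∎
  where open ℕ.≤-Reasoning
CoeffBound-- (suc t) {F} {a} {b} ∣a∣≤ ∣b∣≤ = begin
  ∣ a ℤ.- b ∣                          ≤⟨ ℤ.∣i-j∣≤∣i∣+∣j∣ a b ⟩
  ∣ a ∣ ℕ.+ ∣ b ∣                       ≤⟨ ℕ.+-mono-≤ ∣a∣≤ ∣b∣≤ ⟩
  2 ℕ.^ t ℕ.* F ℕ.+ 2 ℕ.^ t ℕ.* F
    ≡⟨ ℕSolver.solve 2 (λ x f → x :* f :+ x :* f := (con 2 :* x) :* f) ≡.refl (2 ℕ.^ t) F ⟩
  2 ℕ.^ suc t ℕ.* F                    ∎
  where open ℕ.≤-Reasoning
        open ℕSolver using (_:+_; _:*_; _:=_; con)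

CoeffBound⇒∣∣≤ : ∀ t {F v} → CoeffBound t F v → ∣ v ∣ ≤ 2 ℕ.^ (t ∸ 1) ℕ.* F
CoeffBound⇒∣∣≤ zero    {F} {+ k} k≤F = ℕ.≤-trans k≤F (ℕ.≤-reflexive (≡.sym (ℕ.*-identityˡ F)))
CoeffBound⇒∣∣≤ (suc t) bound         = bound

CoeffBound-scaled : ∀ t {F v d n} → CoeffBound t F v → F ℕ.* d ≤ n → ∣ v ∣ ℕ.* d ≤ 2 ℕ.^ (t ∸ 1) ℕ.* n
CoeffBound-scaled t {F} {v} {d} {n} bound Fd≤n = begin
  ∣ v ∣ ℕ.* d                      ≤⟨ ℕ.*-monoˡ-≤ d (CoeffBound⇒∣∣≤ t bound) ⟩
  2 ℕ.^ (t ∸ 1) ℕ.* F ℕ.* d        ≡⟨ ℕ.*-assoc (2 ℕ.^ (t ∸ 1)) F d ⟩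
  2 ℕ.^ (t ∸ 1) ℕ.* (F ℕ.* d)      ≤⟨ ℕ.*-monoʳ-≤ (2 ℕ.^ (t ∸ 1)) Fd≤n ⟩
  2 ℕ.^ (t ∸ 1) ℕ.* n              ∎
  where open ℕ.≤-Reasoning

module Casts (K : CommutativeRing 0ℓ 0ℓ) where
  open CommutativeRing K renaming (Carrier to C)
  open RingDefs K
  open import Relation.Binary.Reasoning.Setoid setoid
  open import Algebra.Properties.Group +-group using (ε⁻¹≈ε; ⁻¹-involutive)
  open import Algebra.Properties.AbelianGroup +-abelianGroup using (⁻¹-∙-comm)
  open import Tactic.RingSolver.NonReflective (fromCommutativeRing K (λ _ → nothing)) using (solve; _⊜_; _⊕_)

  natK-+ : ∀ m n → natK (m ℕ.+ n) ≈ natK m + natK n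
  natK-+ zero    n = sym (+-identityˡ _)
  natK-+ (suc m) n = trans (+-congˡ (natK-+ m n)) (sym (+-assoc _ _ _))

  intK-⊖ : ∀ m n → intK (m ℤ.⊖ n) ≈ natK m - natK n
  intK-⊖ m       zero    = sym (trans (+-congˡ ε⁻¹≈ε) (+-identityʳ _))
  intK-⊖ zero    (suc n) = sym (+-identityˡ _)
  intK-⊖ (suc m) (suc n) = begin
    intK (suc m ℤ.⊖ suc n)                ≡⟨ ≡.cong intK (ℤ.[1+m]⊖[1+n]≡m⊖n m n) ⟩
    intK (m ℤ.⊖ n)                        ≈⟨ intK-⊖ m n ⟩
    natK m - natK n                       ≈⟨ sym (+-identityˡ _) ⟩
    0# + (natK m - natK n)                ≈⟨ +-congʳ (sym (-‿inverseʳ 1#)) ⟩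
    (1# - 1#) + (natK m - natK n)         ≈⟨ solve 4 (λ a b c d → ((a ⊕ b) ⊕ (c ⊕ d)) ⊜ ((a ⊕ c) ⊕ (b ⊕ d)))
                                                    refl 1# (- 1#) (natK m) (- natK n) ⟩
    (1# + natK m) + (- 1# - natK n)       ≈⟨ +-congˡ (⁻¹-∙-comm 1# (natK n)) ⟩
    (1# + natK m) - (1# + natK n)         ∎

  intK-neg : ∀ a → intK (ℤ.- a) ≈ - intK a
  intK-neg (+ zero)    = sym ε⁻¹≈ε
  intK-neg (+ suc m)   = refl
  intK-neg ℤ.-[1+ m ]  = sym (⁻¹-involutive _)

  intK-+ : ∀ a b → intK (a ℤ.+ b) ≈ intK a + intK b
  intK-+ ℤ.-[1+ m ] ℤ.-[1+ n ] = begin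
    - (1# + (1# + natK (m ℕ.+ n)))     ≈⟨ -‿cong (+-congˡ (+-congˡ (natK-+ m n))) ⟩
    - (1# + (1# + (natK m + natK n)))  ≈⟨ -‿cong (solve 3 (λ o a b → (o ⊕ (o ⊕ (a ⊕ b))) ⊜ ((o ⊕ a) ⊕ (o ⊕ b)))
                                                      refl 1# (natK m) (natK n)) ⟩
    - ((1# + natK m) + (1# + natK n))  ≈⟨ sym (⁻¹-∙-comm _ _) ⟩
    - (1# + natK m) - (1# + natK n)    ∎
  intK-+ ℤ.-[1+ m ] (+ n)      = trans (intK-⊖ n (suc m)) (+-comm _ _)
  intK-+ (+ m)      ℤ.-[1+ n ] = intK-⊖ m (suc n)
  intK-+ (+ m)      (+ n)      = natK-+ m n

  intK-- : ∀ a b → intK (a ℤ.- b) ≈ intK a - intK b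
  intK-- a b = trans (intK-+ a (ℤ.- b)) (+-congˡ (intK-neg b))

module RingSums (K : CommutativeRing 0ℓ 0ℓ) where
  open CommutativeRing K renaming (Carrier to C)
  open RingDefs K
  open RangeSums commutativeSemiring public
  open Casts K
  open import Relation.Binary.Reasoning.Setoid setoid
  open import Algebra.Properties.Ring ring using (-1*x≈-x)
  open import Algebra.Properties.Group +-group using (ε⁻¹≈ε)
  open import Algebra.Properties.AbelianGroup +-abelianGroup using (⁻¹-∙-comm)
  open import Tactic.RingSolver.NonReflective (fromCommutativeRing K (λ _ → nothing)) using (solve; _⊜_; _⊕_; _⊗_)

  natK-sum : ∀ {N} (f : Fin N → ℕ) → natK (Counting.sum f) ≈ ∑[ x < N ] natK (f x)
  natK-sum {zero}  f = refl
  natK-sum {suc N} f = trans (natK-+ (f Fin.zero) _) (+-congˡ (natK-sum (λ x → f (Fin.suc x))))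

  -‿+-interchange : ∀ a b c d → (a - b) + (c - d) ≈ (a + c) - (b + d)
  -‿+-interchange a b c d = begin
    (a - b) + (c - d)        ≈⟨ solve 4 (λ a b c d → ((a ⊕ b) ⊕ (c ⊕ d)) ⊜ ((a ⊕ c) ⊕ (b ⊕ d))) refl a (- b) c (- d) ⟩
    (a + c) + (- b + - d)    ≈⟨ +-congˡ (⁻¹-∙-comm b d) ⟩
    (a + c) - (b + d)        ∎

  sumK-map-cong : ∀ {A : Set} (xs : List A) {f g : A → C} → (∀ x → f x ≈ g x) →
                  sumK (map f xs) ≈ sumK (map g xs)
  sumK-map-cong []       f≈g = refl
  sumK-map-cong (x ∷ xs) f≈g = +-cong (f≈g x) (sumK-map-cong xs f≈g)

  sumK-map-++ : ∀ {A : Set} (xs ys : List A) (f : A → C) →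
                sumK (map f (xs ++ ys)) ≈ sumK (map f xs) + sumK (map f ys)
  sumK-map-++ []       ys f = sym (+-identityˡ _)
  sumK-map-++ (x ∷ xs) ys f = trans (+-congˡ (sumK-map-++ xs ys f)) (sym (+-assoc _ _ _))

  sumK-map-concatMap : ∀ {A B : Set} (xs : List A) (g : A → List B) (f : B → C) →
                       sumK (map f (concatMap g xs)) ≈ sumK (map (λ x → sumK (map f (g x))) xs)
  sumK-map-concatMap []       g f = refl
  sumK-map-concatMap (x ∷ xs) g f =
    trans (sumK-map-++ (g x) (concatMap g xs) f) (+-congˡ (sumK-map-concatMap xs g f))

  sumK-map-map : ∀ {A B : Set} (xs : List A) (g : A → B) (f : B → C) →
                 sumK (map f (map g xs)) ≡ sumK (map (λ x → f (g x)) xs)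
  sumK-map-map xs g f = ≡.cong sumK (≡.sym (List.map-∘ xs))

  sumK-map-allFin : ∀ {N} (f : Fin N → C) → sumK (map f (allFin N)) ≈ ∑[ x < N ] f x
  sumK-map-allFin {N} f = reflexive (≡.trans (≡.cong sumK (List.map-tabulate (λ x → x) f)) (sumK-tabulate f))
    where
    sumK-tabulate : ∀ {M} (g : Fin M → C) → sumK (List.tabulate g) ≡ sum g
    sumK-tabulate {zero}  g = ≡.refl
    sumK-tabulate {suc M} g = ≡.cong (λ t → g Fin.zero + t) (sumK-tabulate (λ x → g (Fin.suc x)))

  *-distribˡ-sumK-map : ∀ {A : Set} a (xs : List A) (f : A → C) →
                        a * sumK (map f xs) ≈ sumK (map (λ x → a * f x) xs)
  *-distribˡ-sumK-map a []       f = zeroʳ a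
  *-distribˡ-sumK-map a (x ∷ xs) f = trans (distribˡ a _ _) (+-congˡ (*-distribˡ-sumK-map a xs f))

  sumK-map-distrib-- : ∀ {A : Set} (xs : List A) (f g : A → C) →
                       sumK (map (λ x → f x - g x) xs) ≈ sumK (map f xs) - sumK (map g xs)
  sumK-map-distrib-- []       f g = sym (trans (+-congˡ ε⁻¹≈ε) (+-identityʳ 0#))
  sumK-map-distrib-- (x ∷ xs) f g =
    trans (+-congˡ (sumK-map-distrib-- xs f g)) (-‿+-interchange (f x) (g x) _ _)

  sum-neg : ∀ {N} (f : Fin N → C) → - (∑[ x < N ] f x) ≈ ∑[ x < N ] (- f x)
  sum-neg {N} f = begin
    - (∑[ x < N ] f x)          ≈⟨ sym (-1*x≈-x _) ⟩
    - 1# * ∑[ x < N ] f x       ≈⟨ *-distribˡ-sum {N} (- 1#) f ⟩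
    ∑[ x < N ] (- 1# * f x)     ≈⟨ sum-cong-≋ {N} (λ x → -1*x≈-x (f x)) ⟩
    ∑[ x < N ] (- f x)          ∎

  sum-regroup : ∀ {N} d (key : Fin N → ℕ) → (∀ x → key x < d) → (w : Fin N → ℕ) (g : ℕ → C) (h : Fin N → C) →
                ∑[ x < N ] (natK (w x) * (g (key x) * h x)) ≈
                ∑ℕ[ r < d ] (g r * ∑[ x < N ] (natK (Counting.when (key x ℕ.≟ r) (w x)) * h x))
  sum-regroup {N} d key key<d w g h = begin
    ∑[ x < N ] (natK (w x) * (g (key x) * h x))
      ≈⟨ sum-fibres d key key<d (λ x r → natK (w x) * (g r * h x)) ⟩
    ∑ℕ[ r < d ] ∑[ x < N ] when (key x ℕ.≟ r) (natK (w x) * (g r * h x))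
      ≈⟨ sum-cong-≋ {d} (λ r → sum-cong-≋ {N} (λ x → pull-out (key x ℕ.≟ toℕ r) (w x) (g (toℕ r)) (h x))) ⟩
    ∑ℕ[ r < d ] ∑[ x < N ] (g r * (natK (Counting.when (key x ℕ.≟ r) (w x)) * h x))
      ≈⟨ sum-cong-≋ {d} (λ r → sym (*-distribˡ-sum {N} (g (toℕ r)) _)) ⟩
    ∑ℕ[ r < d ] (g r * ∑[ x < N ] (natK (Counting.when (key x ℕ.≟ r) (w x)) * h x)) ∎
    where
    pull-out : ∀ {A : Set} (a : Dec A) k u v → when a (natK k * (u * v)) ≈ u * (natK (Counting.when a k) * v)
    pull-out a k u v with does a
    ... | Bool.true  = solve 3 (λ k u v → (k ⊗ (u ⊗ v)) ⊜ (u ⊗ (k ⊗ v))) refl (natK k) u v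
    ... | Bool.false = sym (trans (*-congˡ (zeroˡ v)) (zeroʳ u))

  sum-collect : ∀ {N} d (key : Fin N → ℕ) → (∀ x → key x < d) → (w : Fin N → ℕ) (g : ℕ → C) →
                ∑[ x < N ] (natK (w x) * g (key x)) ≈ ∑ℕ[ r < d ] (natK (Counting.fibreWeight key w r) * g r)
  sum-collect {N} d key key<d w g = begin
    ∑[ x < N ] (natK (w x) * g (key x))
      ≈⟨ sum-cong-≋ {N} (λ x → *-congˡ (sym (*-identityʳ _))) ⟩
    ∑[ x < N ] (natK (w x) * (g (key x) * 1#))
      ≈⟨ sum-regroup d key key<d w g (λ _ → 1#) ⟩
    ∑ℕ[ r < d ] (g r * ∑[ x < N ] (natK (Counting.when (key x ℕ.≟ r) (w x)) * 1#))
      ≈⟨ sum-cong-≋ {d} (λ r → trans (*-congˡ (trans (sum-cong-≋ {N} (λ x → *-identityʳ _))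
                                                     (sym (natK-sum (λ x → Counting.when (key x ℕ.≟ toℕ r) (w x))))))
                                      (*-comm _ _)) ⟩
    ∑ℕ[ r < d ] (natK (Counting.fibreWeight key w r) * g r) ∎

  sum-regroup₂ : ∀ {N} q d′ (y z : Fin N → ℕ) → (∀ x → y x < q) → (∀ x → z x < d′) →
                 (w : Fin N → ℕ) (g h : ℕ → C) →
                 ∑[ x < N ] (natK (w x) * (g (y x) * h (z x))) ≈
                 ∑ℕ[ Y < q ] (g Y * ∑ℕ[ Z < d′ ]
                   (natK (Counting.fibreWeight z (λ x → Counting.when (y x ℕ.≟ Y) (w x)) Z) * h Z))
  sum-regroup₂ q d′ y z y<q z<d′ w g h = trans (sum-regroup q y y<q w g (λ x → h (z x)))
    (sum-cong-≋ {q} (λ Y → *-congˡ (sum-collect d′ z z<d′ _ h)))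

module Powers (K : CommutativeRing 0ℓ 0ℓ) where
  open CommutativeRing K renaming (Carrier to C)
  open RingDefs K
  open import Relation.Binary.Reasoning.Setoid setoid
  open import Algebra.Properties.Semiring.Exp semiring using (_^_; ^-congˡ; ^-homo-*; ^-assocʳ)

  pow≡^ : ∀ x n → pow x n ≡ x ^ n
  pow≡^ x zero    = ≡.refl
  pow≡^ x (suc n) = ≡.cong (x *_) (pow≡^ x n)

  pow-cong : ∀ {x y} n → x ≈ y → pow x n ≈ pow y n
  pow-cong {x} {y} n x≈y rewrite pow≡^ x n | pow≡^ y n = ^-congˡ n x≈y

  pow-+ : ∀ x m n → pow x (m ℕ.+ n) ≈ pow x m * pow x n
  pow-+ x m n rewrite pow≡^ x (m ℕ.+ n) | pow≡^ x m | pow≡^ x n = ^-homo-* x m n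

  pow-* : ∀ x m n → pow x (m ℕ.* n) ≈ pow (pow x m) n
  pow-* x m n rewrite pow≡^ x (m ℕ.* n) | pow≡^ (pow x m) n | pow≡^ x m = sym (^-assocʳ x m n)

  pow-*-comm : ∀ x m n → pow (pow x m) n ≈ pow (pow x n) m
  pow-*-comm x m n = trans (sym (pow-* x m n))
    (trans (reflexive (≡.cong (pow x) (ℕ.*-comm m n))) (pow-* x n m))

  pow-1# : ∀ n → pow 1# n ≈ 1#
  pow-1# zero    = refl
  pow-1# (suc n) = trans (*-identityˡ _) (pow-1# n)

  pow-multiple : ∀ {x d} → pow x d ≈ 1# → ∀ k → pow x (k ℕ.* d) ≈ 1#
  pow-multiple {x} {d} x^d≈1 k = begin
    pow x (k ℕ.* d)  ≡⟨ ≡.cong (pow x) (ℕ.*-comm k d) ⟩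
    pow x (d ℕ.* k)  ≈⟨ pow-* x d k ⟩
    pow (pow x d) k  ≈⟨ pow-cong k x^d≈1 ⟩
    pow 1# k         ≈⟨ pow-1# k ⟩
    1#               ∎

  pow-% : ∀ {x d} .{{_ : ℕ.NonZero d}} → pow x d ≈ 1# → ∀ m → pow x (m % d) ≈ pow x m
  pow-% {x} {d} x^d≈1 m = begin
    pow x (m % d)                          ≈⟨ sym (*-identityʳ _) ⟩
    pow x (m % d) * 1#                     ≈⟨ *-congˡ (sym (pow-multiple x^d≈1 (m / d))) ⟩
    pow x (m % d) * pow x (m / d ℕ.* d)     ≈⟨ sym (pow-+ x (m % d) _) ⟩
    pow x (m % d ℕ.+ m / d ℕ.* d)           ≡⟨ ≡.cong (pow x) (≡.sym (m≡m%n+[m/n]*n m d)) ⟩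
    pow x m                                ∎

  pow-coprime-split : ∀ {x} q d′ → pow x (q ℕ.* d′) ≈ 1# → Coprime q d′ →
                      ∃₂ λ a b → ∀ r → pow x r ≈ pow (pow x d′) (r ℕ.* a) * pow (pow x q) (r ℕ.* b)
  pow-coprime-split {x} q d′ x^qd≈1 cop with coprime⇒bézout-mod q d′ cop
  ... | a , b , k , ad+bq≡1+kqd = a , b , λ r → begin
    pow x r                                           ≈⟨ sym (*-identityʳ _) ⟩
    pow x r * 1#                                      ≈⟨ *-congˡ (sym (pow-multiple x^qd≈1 (r ℕ.* k))) ⟩
    pow x r * pow x (r ℕ.* k ℕ.* (q ℕ.* d′))           ≈⟨ sym (pow-+ x r _) ⟩
    pow x (r ℕ.+ r ℕ.* k ℕ.* (q ℕ.* d′))               ≡⟨ ≡.cong (pow x) (exponent r) ⟩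
    pow x (d′ ℕ.* (r ℕ.* a) ℕ.+ q ℕ.* (r ℕ.* b))       ≈⟨ pow-+ x (d′ ℕ.* (r ℕ.* a)) (q ℕ.* (r ℕ.* b)) ⟩
    pow x (d′ ℕ.* (r ℕ.* a)) * pow x (q ℕ.* (r ℕ.* b)) ≈⟨ *-cong (pow-* x d′ _) (pow-* x q _) ⟩
    pow (pow x d′) (r ℕ.* a) * pow (pow x q) (r ℕ.* b) ∎
    where
    open ℕSolver using (solve; _:+_; _:*_; _:=_; con)
    exponent : ∀ r → r ℕ.+ r ℕ.* k ℕ.* (q ℕ.* d′) ≡ d′ ℕ.* (r ℕ.* a) ℕ.+ q ℕ.* (r ℕ.* b)
    exponent r =
      ≡.trans (solve 4 (λ r k q d → r :+ r :* k :* (q :* d) := r :* (con 1 :+ k :* (q :* d))) ≡.refl r k q d′)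
      (≡.trans (≡.cong (r ℕ.*_) (≡.sym ad+bq≡1+kqd))
        (solve 5 (λ r a b q d → r :* (a :* d :+ b :* q) := d :* (r :* a) :+ q :* (r :* b)) ≡.refl r a b q d′))

  crt-decomposition : ∀ {ζ} q d′ → 0 < q → 0 < d′ → pow ζ (q ℕ.* d′) ≈ 1# → Coprime q d′ → ∀ r →
                      ∃₂ λ Y Z → (Y < q × Z < d′) × pow ζ r ≈ pow (pow ζ d′) Y * pow (pow ζ q) Z
  crt-decomposition {ζ} q d′ 0<q 0<d′ ζ^qd≈1 coprime r =
    (r ℕ.* a) % q , (r ℕ.* b) % d′ , (m%n<n (r ℕ.* a) q , m%n<n (r ℕ.* b) d′) , (begin
      pow ζ r                                                ≈⟨ split r ⟩
      pow (pow ζ d′) (r ℕ.* a) * pow (pow ζ q) (r ℕ.* b)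
        ≈⟨ sym (*-cong (pow-% ω^q≈1 (r ℕ.* a)) (pow-% η^d′≈1 (r ℕ.* b))) ⟩
      pow (pow ζ d′) ((r ℕ.* a) % q) * pow (pow ζ q) ((r ℕ.* b) % d′) ∎)
    where
    instance
      q≢0 : ℕ.NonZero q
      q≢0 = ℕ.>-nonZero 0<q
      d′≢0 : ℕ.NonZero d′
      d′≢0 = ℕ.>-nonZero 0<d′
    a b : ℕ
    a = proj₁ (pow-coprime-split q d′ ζ^qd≈1 coprime)
    b = proj₁ (proj₂ (pow-coprime-split q d′ ζ^qd≈1 coprime))
    split : ∀ r → pow ζ r ≈ pow (pow ζ d′) (r ℕ.* a) * pow (pow ζ q) (r ℕ.* b)
    split = proj₂ (proj₂ (pow-coprime-split q d′ ζ^qd≈1 coprime))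
    ω^q≈1 : pow (pow ζ d′) q ≈ 1#
    ω^q≈1 = trans (sym (pow-* ζ d′ q)) (trans (reflexive (≡.cong (pow ζ) (ℕ.*-comm d′ q))) ζ^qd≈1)
    η^d′≈1 : pow (pow ζ q) d′ ≈ 1#
    η^d′≈1 = trans (sym (pow-* ζ q d′)) ζ^qd≈1

  primitiveRoot-resp-≈ : ∀ {d x y} → x ≈ y → IsPrimitiveRoot d x → IsPrimitiveRoot d y
  primitiveRoot-resp-≈ {d} x≈y (x^d≈1 , minimal) =
    trans (pow-cong d (sym x≈y)) x^d≈1 , λ e 0<e e<d y^e≈1 → minimal e 0<e e<d (trans (pow-cong e x≈y) y^e≈1)

  primitiveRoot-minimal : ∀ {d ζ k} → IsPrimitiveRoot d ζ → 0 < k → pow ζ k ≈ 1# → d ≤ k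
  primitiveRoot-minimal {d} {ζ} {k} (_ , minimal) 0<k ζ^k≈1 =
    ℕ.≮⇒≥ (λ k<d → minimal k 0<k k<d ζ^k≈1)

  primitiveRoot-pow : ∀ {ζ} a b → 0 < a → IsPrimitiveRoot (a ℕ.* b) ζ → IsPrimitiveRoot b (pow ζ a)
  primitiveRoot-pow {ζ} a b 0<a (ζ^ab≈1 , minimal) =
    trans (sym (pow-* ζ a b)) ζ^ab≈1 ,
    λ e 0<e e<b ζ^ae≈1 → minimal (a ℕ.* e) (ℕ.*-mono-< 0<a 0<e) (ℕ.*-monoʳ-< a e<b) (trans (pow-* ζ a e) ζ^ae≈1)
    where
    instance
      a≢0 : ℕ.NonZero a
      a≢0 = ℕ.>-nonZero 0<a

  pow-primitive⇒primitive : ∀ {ω d} m → pow ω d ≈ 1# → IsPrimitiveRoot d (pow ω m) → IsPrimitiveRoot d ω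
  pow-primitive⇒primitive {ω} m ω^d≈1 (_ , minimal) =
    ω^d≈1 , λ e 0<e e<d ω^e≈1 → minimal e 0<e e<d (trans (pow-*-comm ω m e) (trans (pow-cong m ω^e≈1) (pow-1# m)))

  pow-primitive⇒coprime : ∀ {ω d} m → 0 < d → pow ω d ≈ 1# → IsPrimitiveRoot d (pow ω m) → Coprime m d
  pow-primitive⇒coprime {ω} {d} m 0<d ω^d≈1 prim {i} (divides s m≡s*i , divides k d≡k*i) =
    ℕ.≤-antisym i≤1 (ℕ.>-nonZero⁻¹ i {{ℕ.m*n≢0⇒n≢0 k}})
    where
    instance
      ki≢0 : ℕ.NonZero (k ℕ.* i)
      ki≢0 = ℕ.>-nonZero (≡.subst (0 <_) d≡k*i 0<d)
      k≢0 : ℕ.NonZero k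
      k≢0 = ℕ.m*n≢0⇒m≢0 k
    mk≡sd : m ℕ.* k ≡ s ℕ.* d
    mk≡sd = ≡.trans (≡.cong (ℕ._* k) m≡s*i)
              (≡.trans (ℕ.*-assoc s i k) (≡.cong (s ℕ.*_) (≡.trans (ℕ.*-comm i k) (≡.sym d≡k*i))))
    ω^m^k≈1 : pow (pow ω m) k ≈ 1#
    ω^m^k≈1 = trans (sym (pow-* ω m k)) (trans (reflexive (≡.cong (pow ω) mk≡sd)) (pow-multiple ω^d≈1 s))
    i≤1 : i ≤ 1
    i≤1 = ℕ.*-cancelˡ-≤ k (ℕ.≤-trans (ℕ.≤-reflexive (≡.sym d≡k*i))
            (ℕ.≤-trans (primitiveRoot-minimal prim (ℕ.>-nonZero⁻¹ k) ω^m^k≈1)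
                       (ℕ.≤-reflexive (≡.sym (ℕ.*-identityʳ k)))))

  primitiveRoot-generates : ∀ {ζ ω d} m → 0 < d → IsPrimitiveRoot d ζ → pow ω d ≈ 1# → ζ ≈ pow ω m →
                            ∃ λ u → ω ≈ pow ζ u
  primitiveRoot-generates {ζ} {ω} {d} m 0<d ζ-prim ω^d≈1 ζ≈ω^m = 1 ℕ.* a , (begin
    ω                                                 ≈⟨ sym (*-identityʳ ω) ⟩
    pow ω 1                                           ≈⟨ split 1 ⟩
    pow (pow ω m) (1 ℕ.* a) * pow (pow ω d) (1 ℕ.* b) ≈⟨ *-cong (pow-cong (1 ℕ.* a) (sym ζ≈ω^m)) ω^d^b≈1 ⟩
    pow ζ (1 ℕ.* a) * 1#                              ≈⟨ *-identityʳ _ ⟩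
    pow ζ (1 ℕ.* a)                                   ∎)
    where
    ω^dm≈1 : pow ω (d ℕ.* m) ≈ 1#
    ω^dm≈1 = trans (reflexive (≡.cong (pow ω) (ℕ.*-comm d m))) (pow-multiple ω^d≈1 m)
    coprime : Coprime d m
    coprime = Coprime.sym (pow-primitive⇒coprime m 0<d ω^d≈1 (primitiveRoot-resp-≈ ζ≈ω^m ζ-prim))
    a b : ℕ
    a = proj₁ (pow-coprime-split d m ω^dm≈1 coprime)
    b = proj₁ (proj₂ (pow-coprime-split d m ω^dm≈1 coprime))
    split : ∀ r → pow ω r ≈ pow (pow ω m) (r ℕ.* a) * pow (pow ω d) (r ℕ.* b)
    split = proj₂ (proj₂ (pow-coprime-split d m ω^dm≈1 coprime))
    ω^d^b≈1 : pow (pow ω d) (1 ℕ.* b) ≈ 1#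
    ω^d^b≈1 = trans (pow-cong (1 ℕ.* b) ω^d≈1) (pow-1# (1 ℕ.* b))

module RootsOfUnity (K : CommutativeRing 0ℓ 0ℓ) (integral : RingDefs.IsIntegralDomain K)
                    (1≉0 : ¬ CommutativeRing._≈_ K (CommutativeRing.1# K) (CommutativeRing.0# K)) where
  open CommutativeRing K renaming (Carrier to C)
  open RingDefs K
  open RingSums K
  open Powers K
  open import Relation.Binary.Reasoning.Setoid setoid
  open import Algebra.Properties.Ring ring using (-‿distribˡ-*; x[y-z]≈xy-xz; [y-z]x≈yx-zx)
  open import Algebra.Properties.Group +-group using (x∙y⁻¹≈ε⇒x≈y; ∙-cancelʳ; inverseʳ-unique)

  *-cancelˡ : ∀ {a b c} → ¬ a ≈ 0# → a * b ≈ a * c → b ≈ c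
  *-cancelˡ {a} {b} {c} a≉0 ab≈ac with integral a (b - c) a[b-c]≈0
    where
    a[b-c]≈0 : a * (b - c) ≈ 0#
    a[b-c]≈0 = trans (x[y-z]≈xy-xz a b c) (trans (+-congʳ ab≈ac) (-‿inverseʳ (a * c)))
  ... | inj₁ a≈0   = ⊥-elim (a≉0 a≈0)
  ... | inj₂ b-c≈0 = x∙y⁻¹≈ε⇒x≈y b c b-c≈0

  root≉0 : ∀ {d ζ} → 0 < d → pow ζ d ≈ 1# → ¬ ζ ≈ 0#
  root≉0 {suc d} {ζ} _ ζ^d≈1 ζ≈0 = 1≉0 (begin
    1#              ≈⟨ sym ζ^d≈1 ⟩
    ζ * pow ζ d     ≈⟨ *-congʳ ζ≈0 ⟩
    0# * pow ζ d    ≈⟨ zeroˡ _ ⟩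
    0#              ∎)

  pow≉0 : ∀ {x} → ¬ x ≈ 0# → ∀ n → ¬ pow x n ≈ 0#
  pow≉0 x≉0 zero    = 1≉0
  pow≉0 x≉0 (suc n) xxⁿ≈0 with integral _ _ xxⁿ≈0
  ... | inj₁ x≈0  = x≉0 x≈0
  ... | inj₂ xⁿ≈0 = pow≉0 x≉0 n xⁿ≈0

  primitiveRoot-pow-distinct : ∀ {d ζ a b} → IsPrimitiveRoot d ζ → a < b → b < d →
                               ¬ pow ζ a ≈ pow ζ b
  primitiveRoot-pow-distinct {d} {ζ} {a} {b} (ζ^d≈1 , minimal) a<b b<d ζ^a≈ζ^b =
    minimal (b ∸ a) (ℕ.m<n⇒0<n∸m a<b) (ℕ.≤-<-trans (ℕ.m∸n≤m b a) b<d)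
      (sym (*-cancelˡ (pow≉0 (root≉0 (ℕ.≤-<-trans z≤n b<d) ζ^d≈1) a) (begin
        pow ζ a * 1#                ≈⟨ *-identityʳ _ ⟩
        pow ζ a                     ≈⟨ ζ^a≈ζ^b ⟩
        pow ζ b                     ≡⟨ ≡.cong (pow ζ) (≡.sym (ℕ.m+[n∸m]≡n (ℕ.<⇒≤ a<b))) ⟩
        pow ζ (a ℕ.+ (b ∸ a))       ≈⟨ pow-+ ζ a (b ∸ a) ⟩
        pow ζ a * pow ζ (b ∸ a)     ∎)))

  primitiveRoot-pow-injective : ∀ {d ζ a b} → IsPrimitiveRoot d ζ → a < d → b < d →
                                pow ζ a ≈ pow ζ b → a ≡ b
  primitiveRoot-pow-injective {a = a} {b} prim a<d b<d ζ^a≈ζ^b with ℕ.<-cmp a b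
  ... | tri< a<b _ _ = ⊥-elim (primitiveRoot-pow-distinct prim a<b b<d ζ^a≈ζ^b)
  ... | tri≈ _ a≡b _ = a≡b
  ... | tri> _ _ b<a = ⊥-elim (primitiveRoot-pow-distinct prim b<a a<d (sym ζ^a≈ζ^b))

  primitiveRoot-geometricSum : ∀ {p w} → IsPrimitiveRoot p w → 1 < p → ∑ℕ[ i < p ] pow w i ≈ 0#
  primitiveRoot-geometricSum {p} {w} (w^p≈1 , minimal) 1<p with integral (w - 1#) T [w-1]T≈0
    where
    T : C
    T = ∑ℕ[ i < p ] pow w i
    1+wT≈T+1 : 1# + w * T ≈ T + 1#
    1+wT≈T+1 = begin
      1# + w * T                       ≈⟨ +-congˡ (*-distribˡ-sum {p} w (λ i → pow w (toℕ i))) ⟩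
      ∑ℕ[ i < suc p ] pow w i          ≈⟨ sumℕ-last p (pow w) ⟩
      T + pow w p                      ≈⟨ +-congˡ w^p≈1 ⟩
      T + 1#                           ∎
    [w-1]T≈0 : (w - 1#) * T ≈ 0#
    [w-1]T≈0 = begin
      (w - 1#) * T       ≈⟨ [y-z]x≈yx-zx T w 1# ⟩
      w * T - 1# * T     ≈⟨ +-cong (∙-cancelʳ 1# (w * T) T (trans (+-comm _ _) 1+wT≈T+1)) (-‿cong (*-identityˡ T)) ⟩
      T - T              ≈⟨ -‿inverseʳ T ⟩
      0#                 ∎
  ... | inj₁ w-1≈0 = ⊥-elim (minimal 1 (s≤s z≤n) 1<p (trans (*-identityʳ w) (x∙y⁻¹≈ε⇒x≈y w 1# w-1≈0)))
  ... | inj₂ T≈0   = T≈0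

  topBlock-pow : ∀ {ω} p P → 1 < p → IsPrimitiveRoot p (pow ω P) → ∀ l →
                 pow ω ((p ∸ 1) ℕ.* P ℕ.+ l) ≈ - ∑ℕ[ k < p ∸ 1 ] pow ω (k ℕ.* P ℕ.+ l)
  topBlock-pow {ω} (suc p′) P 1<p w-prim l =
    inverseʳ-unique _ _ (trans (sym (sumℕ-last p′ (λ k → pow ω (k ℕ.* P ℕ.+ l)))) columnSum)
    where
    split : ∀ k → pow ω (k ℕ.* P ℕ.+ l) ≈ pow (pow ω P) k * pow ω l
    split k = trans (pow-+ ω (k ℕ.* P) l) (*-congʳ (trans (reflexive (≡.cong (pow ω) (ℕ.*-comm k P))) (pow-* ω P k)))
    columnSum : ∑ℕ[ k < suc p′ ] pow ω (k ℕ.* P ℕ.+ l) ≈ 0#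
    columnSum = begin
      ∑ℕ[ k < suc p′ ] pow ω (k ℕ.* P ℕ.+ l)       ≈⟨ sum-cong-≋ {suc p′} (λ k → split (toℕ k)) ⟩
      ∑ℕ[ k < suc p′ ] (pow (pow ω P) k * pow ω l)
        ≈⟨ *-distribʳ-sum {suc p′} (pow ω l) (λ k → pow (pow ω P) (toℕ k)) ⟨
      (∑ℕ[ k < suc p′ ] pow (pow ω P) k) * pow ω l  ≈⟨ *-congʳ (primitiveRoot-geometricSum w-prim 1<p) ⟩
      0# * pow ω l                                 ≈⟨ zeroˡ _ ⟩
      0#                                           ∎

  sum-eliminateTopBlock : ∀ {ω} p P → 1 < p → IsPrimitiveRoot p (pow ω P) → (g : ℕ → C) →
    ∑ℕ[ Y < p ℕ.* P ] (pow ω Y * g Y) ≈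
    ∑ℕ[ k < p ∸ 1 ] ∑ℕ[ l < P ] (pow ω (k ℕ.* P ℕ.+ l) * (g (k ℕ.* P ℕ.+ l) - g ((p ∸ 1) ℕ.* P ℕ.+ l)))
  sum-eliminateTopBlock {ω} (suc p′) P 1<p w-prim g = begin
    ∑ℕ[ Y < suc p′ ℕ.* P ] (pow ω Y * g Y)                    ≈⟨ sumℕ-blocks (suc p′) P (λ Y → pow ω Y * g Y) ⟩
    ∑ℕ[ k < suc p′ ] ∑ℕ[ l < P ] A k l                        ≈⟨ sumℕ-last p′ (λ k → ∑ℕ[ l < P ] A k l) ⟩
    ∑ℕ[ k < p′ ] ∑ℕ[ l < P ] A k l + ∑ℕ[ l < P ] A p′ l        ≈⟨ +-congˡ topBlock ⟩
    ∑ℕ[ k < p′ ] ∑ℕ[ l < P ] A k l + ∑ℕ[ k < p′ ] ∑ℕ[ l < P ] (- B k l)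
      ≈⟨ ∑-distrib-+ {p′} (λ k → ∑ℕ[ l < P ] A (toℕ k) l) _ ⟨
    ∑ℕ[ k < p′ ] (∑ℕ[ l < P ] A k l + ∑ℕ[ l < P ] (- B k l))
      ≈⟨ sum-cong-≋ {p′} (λ k → sym (∑-distrib-+ {P} (λ l → A (toℕ k) (toℕ l)) _)) ⟩
    ∑ℕ[ k < p′ ] ∑ℕ[ l < P ] (A k l - B k l)
      ≈⟨ sum-cong-≋ {p′} (λ k → sum-cong-≋ {P} (λ l → sym (x[y-z]≈xy-xz _ _ _))) ⟩
    ∑ℕ[ k < p′ ] ∑ℕ[ l < P ] (pow ω (k ℕ.* P ℕ.+ l) * (g (k ℕ.* P ℕ.+ l) - g (p′ ℕ.* P ℕ.+ l))) ∎
    where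
    A B : ℕ → ℕ → C
    A k l = pow ω (k ℕ.* P ℕ.+ l) * g (k ℕ.* P ℕ.+ l)
    B k l = pow ω (k ℕ.* P ℕ.+ l) * g (p′ ℕ.* P ℕ.+ l)
    negate : ∀ l → (- ∑ℕ[ k < p′ ] pow ω (k ℕ.* P ℕ.+ l)) * g (p′ ℕ.* P ℕ.+ l) ≈ ∑ℕ[ k < p′ ] (- B k l)
    negate l = trans (sym (-‿distribˡ-* _ _))
      (trans (-‿cong (*-distribʳ-sum {p′} (g (p′ ℕ.* P ℕ.+ l)) _)) (sum-neg {p′} (λ k → B (toℕ k) l)))
    topBlock : ∑ℕ[ l < P ] A p′ l ≈ ∑ℕ[ k < p′ ] ∑ℕ[ l < P ] (- B k l)
    topBlock = begin
      ∑ℕ[ l < P ] A p′ l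
        ≈⟨ sum-cong-≋ {P} (λ l → *-congʳ (topBlock-pow (suc p′) P 1<p w-prim (toℕ l))) ⟩
      ∑ℕ[ l < P ] ((- ∑ℕ[ k < p′ ] pow ω (k ℕ.* P ℕ.+ l)) * g (p′ ℕ.* P ℕ.+ l))
        ≈⟨ sum-cong-≋ {P} (λ l → negate (toℕ l)) ⟩
      ∑ℕ[ l < P ] ∑ℕ[ k < p′ ] (- B k l)
        ≈⟨ ∑-comm {P} {p′} (λ l k → - B (toℕ k) (toℕ l)) ⟩
      ∑ℕ[ k < p′ ] ∑ℕ[ l < P ] (- B k l) ∎

module BasisB (K : CommutativeRing 0ℓ 0ℓ) where
  open CommutativeRing K renaming (Carrier to C)
  open RingDefs K
  open Casts K
  open RingSums K
  open Powers K
  open import Relation.Binary.Reasoning.Setoid setoid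
  open import Algebra.Properties.Ring ring using ([y-z]x≈yx-zx)

  sumIdx-∷ : ∀ p a fs (f : Idx ((p , a) ∷ fs) → C) →
             sumK (map f (allIdx ((p , a) ∷ fs))) ≈
             ∑[ k < p ∸ 1 ] ∑[ l < p ℕ.^ (a ∸ 1) ] sumK (map (λ i → f (k , l , i)) (allIdx fs))
  sumIdx-∷ p a fs f = begin
    sumK (map f (concatMap G (allFin (p ∸ 1))))                        ≈⟨ sumK-map-concatMap (allFin (p ∸ 1)) G f ⟩
    sumK (map (λ k → sumK (map f (G k))) (allFin (p ∸ 1)))             ≈⟨ sumK-map-allFin (λ k → sumK (map f (G k))) ⟩
    ∑[ k < p ∸ 1 ] sumK (map f (G k))                                  ≈⟨ sum-cong-≋ {p ∸ 1} inner ⟩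
    ∑[ k < p ∸ 1 ] ∑[ l < P ] sumK (map (λ i → f (k , l , i)) (allIdx fs)) ∎
    where
    P : ℕ
    P = p ℕ.^ (a ∸ 1)
    G : Fin (p ∸ 1) → List (Idx ((p , a) ∷ fs))
    G k = concatMap (λ l → map (λ i → k , l , i) (allIdx fs)) (allFin P)
    inner : ∀ k → sumK (map f (G k)) ≈ ∑[ l < P ] sumK (map (λ i → f (k , l , i)) (allIdx fs))
    inner k = begin
      sumK (map f (G k))                                                     ≈⟨ sumK-map-concatMap (allFin P) _ f ⟩
      sumK (map (λ l → sumK (map f (map (λ i → k , l , i) (allIdx fs)))) (allFin P)) ≈⟨ sumK-map-allFin {P} _ ⟩
      ∑[ l < P ] sumK (map f (map (λ i → k , l , i) (allIdx fs)))
        ≈⟨ sum-cong-≋ {P} (λ l → reflexive (sumK-map-map (allIdx fs) _ f)) ⟩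
      ∑[ l < P ] sumK (map (λ i → f (k , l , i)) (allIdx fs))                  ∎

  basisElt-∷ : ∀ ζ p a fs k l i →
               basisElt K ζ ((p , suc a) ∷ fs) (k , l , i) ≈
               pow (pow ζ (prodPP fs)) (toℕ k ℕ.* p ℕ.^ a ℕ.+ toℕ l) * basisElt K (pow ζ (p ℕ.^ suc a)) fs i
  basisElt-∷ ζ p a fs k l i = begin
    pow ζ (E ℕ.* (1 ℕ.* d′) ℕ.+ bexp fs (1 ℕ.* q) i)      ≈⟨ pow-+ ζ (E ℕ.* (1 ℕ.* d′)) _ ⟩
    pow ζ (E ℕ.* (1 ℕ.* d′)) * pow ζ (bexp fs (1 ℕ.* q) i)
      ≡⟨ ≡.cong₂ (λ u v → pow ζ u * pow ζ v) E[1d′]≡d′E bexp[1q]≡q*bexp ⟩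
    pow ζ (d′ ℕ.* E) * pow ζ (q ℕ.* bexp fs 1 i)           ≈⟨ *-cong (pow-* ζ d′ E) (pow-* ζ q (bexp fs 1 i)) ⟩
    pow (pow ζ d′) E * pow (pow ζ q) (bexp fs 1 i)         ∎
    where
    E d′ q : ℕ
    E  = toℕ k ℕ.* p ℕ.^ a ℕ.+ toℕ l
    d′ = prodPP fs
    q  = p ℕ.^ suc a
    E[1d′]≡d′E : E ℕ.* (1 ℕ.* d′) ≡ d′ ℕ.* E
    E[1d′]≡d′E = ≡.trans (≡.cong (E ℕ.*_) (ℕ.*-identityˡ d′)) (ℕ.*-comm E d′)
    bexp[1q]≡q*bexp : bexp fs (1 ℕ.* q) i ≡ q ℕ.* bexp fs 1 i
    bexp[1q]≡q*bexp = ≡.trans (bexp-scale fs (1 ℕ.* q) i) (≡.cong (ℕ._* bexp fs 1 i) (ℕ.*-identityˡ q))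

  combB-∷ : ∀ ζ p a fs (c : Idx ((p , suc a) ∷ fs) → ℤ) →
            combB K ζ ((p , suc a) ∷ fs) c ≈
            ∑[ k < p ∸ 1 ] ∑[ l < p ℕ.^ a ]
              (pow (pow ζ (prodPP fs)) (toℕ k ℕ.* p ℕ.^ a ℕ.+ toℕ l) *
               combB K (pow ζ (p ℕ.^ suc a)) fs (λ i → c (k , l , i)))
  combB-∷ ζ p a fs c = trans (sumIdx-∷ p (suc a) fs _)
    (sum-cong-≋ {p ∸ 1} (λ k → sum-cong-≋ {p ℕ.^ a} (λ l →
      trans (sumK-map-cong (allIdx fs) (λ i → trans (*-congˡ (basisElt-∷ ζ p a fs k l i)) (x*[y*z]≈y*[x*z] _ _ _)))
            (sym (*-distribˡ-sumK-map _ (allIdx fs) _)))))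
    where
    x*[y*z]≈y*[x*z] : ∀ x y z → x * (y * z) ≈ y * (x * z)
    x*[y*z]≈y*[x*z] x y z = trans (sym (*-assoc x y z)) (trans (*-congʳ (*-comm x y)) (*-assoc y x z))

  combB-- : ∀ ζ fs (c c′ : Idx fs → ℤ) → combB K ζ fs (λ i → c i ℤ.- c′ i) ≈ combB K ζ fs c - combB K ζ fs c′
  combB-- ζ fs c c′ =
    trans (sumK-map-cong (allIdx fs) (λ i → trans (*-congʳ (intK-- (c i) (c′ i))) ([y-z]x≈yx-zx _ _ _)))
          (sumK-map-distrib-- (allIdx fs) _ _)

module CRTRegrouping (K : CommutativeRing 0ℓ 0ℓ) (integral : RingDefs.IsIntegralDomain K)
                     (1≉0 : ¬ CommutativeRing._≈_ K (CommutativeRing.1# K) (CommutativeRing.0# K))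
                     {ζ : CommutativeRing.Carrier K} (q d′ : ℕ) (0<q : 0 < q) (0<d′ : 0 < d′)
                     (ζ-prim : RingDefs.IsPrimitiveRoot K (q ℕ.* d′) ζ) (q⊥d′ : Coprime q d′)
                     (m : ℕ → ℕ) where
  open CommutativeRing K renaming (Carrier to C)
  open RingDefs K
  open RingSums K
  open Powers K
  open RootsOfUnity K integral 1≉0

  private
    crt : ∀ r → ∃₂ λ Y Z → (Y < q × Z < d′) × pow ζ r ≈ pow (pow ζ d′) Y * pow (pow ζ q) Z
    crt = crt-decomposition q d′ 0<q 0<d′ (proj₁ ζ-prim) q⊥d′
    y z : Fin (q ℕ.* d′) → ℕ
    y r = proj₁ (crt (toℕ r))
    z r = proj₁ (proj₂ (crt (toℕ r)))
    y<q : ∀ r → y r < q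
    y<q r = proj₁ (proj₁ (proj₂ (proj₂ (crt (toℕ r)))))
    z<d′ : ∀ r → z r < d′
    z<d′ r = proj₂ (proj₁ (proj₂ (proj₂ (crt (toℕ r)))))
    ζ^r≈ω^yη^z : ∀ r → pow ζ (toℕ r) ≈ pow (pow ζ d′) (y r) * pow (pow ζ q) (z r)
    ζ^r≈ω^yη^z r = proj₂ (proj₂ (proj₂ (crt (toℕ r))))
    yz-injective : ∀ r r′ → y r ≡ y r′ → z r ≡ z r′ → r ≡ r′
    yz-injective r r′ y≡ z≡ = Fin.toℕ-injective (primitiveRoot-pow-injective ζ-prim (Fin.toℕ<n r) (Fin.toℕ<n r′)
      (trans (ζ^r≈ω^yη^z r)
        (trans (reflexive (≡.cong₂ (λ Y Z → pow (pow ζ d′) Y * pow (pow ζ q) Z) y≡ z≡)) (sym (ζ^r≈ω^yη^z r′)))))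

  crtMultiplicity : ℕ → ℕ → ℕ
  crtMultiplicity Y = Counting.fibreWeight z (λ r → Counting.when (y r ℕ.≟ Y) (m (toℕ r)))

  crtMultiplicity≤ : ∀ {F} → (∀ r → r < q ℕ.* d′ → m r ≤ F) → ∀ Y Z → crtMultiplicity Y Z ≤ F
  crtMultiplicity≤ m≤F Y Z = Counting.sum-≤-singleSupport summand single λ r →
    ℕ.≤-trans (Counting.when-≤ (z r ℕ.≟ Z) _) (ℕ.≤-trans (Counting.when-≤ (y r ℕ.≟ Y) _) (m≤F (toℕ r) (Fin.toℕ<n r)))
    where
    summand : Fin (q ℕ.* d′) → ℕ
    summand r = Counting.when (z r ℕ.≟ Z) (Counting.when (y r ℕ.≟ Y) (m (toℕ r)))
    single : ∀ r r′ → summand r ≢ 0 → summand r′ ≢ 0 → r ≡ r′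
    single r r′ s≢0 s′≢0 with Counting.when-≢0 (z r ℕ.≟ Z) _ s≢0 | Counting.when-≢0 (z r′ ℕ.≟ Z) _ s′≢0
    ... | z≡Z , t≢0 | z′≡Z , t′≢0 = yz-injective r r′
      (≡.trans (proj₁ (Counting.when-≢0 (y r ℕ.≟ Y) _ t≢0)) (≡.sym (proj₁ (Counting.when-≢0 (y r′ ℕ.≟ Y) _ t′≢0))))
      (≡.trans z≡Z (≡.sym z′≡Z))

  powerSum-crt : ∑ℕ[ r < q ℕ.* d′ ] (natK (m r) * pow ζ r) ≈
                 ∑ℕ[ Y < q ] (pow (pow ζ d′) Y * ∑ℕ[ Z < d′ ] (natK (crtMultiplicity Y Z) * pow (pow ζ q) Z))
  powerSum-crt = trans (sum-cong-≋ {q ℕ.* d′} (λ r → *-congˡ (ζ^r≈ω^yη^z r)))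
    (sum-regroup₂ q d′ y z y<q z<d′ (λ r → m (toℕ r)) (pow (pow ζ d′)) (pow (pow ζ q)))

module PowerSumExpansion (K : CommutativeRing 0ℓ 0ℓ) (integral : RingDefs.IsIntegralDomain K)
                         (1≉0 : ¬ CommutativeRing._≈_ K (CommutativeRing.1# K) (CommutativeRing.0# K)) where
  open CommutativeRing K renaming (Carrier to C)
  open RingDefs K
  open RingSums K
  open Powers K
  open RootsOfUnity K integral 1≉0
  open BasisB K
  open import Relation.Binary.Reasoning.Setoid setoid

  Expansion : (fs : List (ℕ × ℕ)) → C → ℕ → (ℕ → ℕ) → Set
  Expansion fs ζ F m = Σ (Idx fs → ℤ) λ c →
    ∑ℕ[ r < prodPP fs ] (natK (m r) * pow ζ r) ≈ combB K ζ fs c × (∀ i → CoeffBound (length fs) F (c i))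

  powerSum-expansion : ∀ fs → All PrimePower fs → AllPairs (λ q r → proj₁ q ≢ proj₁ r) fs →
                       ∀ {ζ} → IsPrimitiveRoot (prodPP fs) ζ →
                       ∀ F (m : ℕ → ℕ) → (∀ r → r < prodPP fs → m r ≤ F) → Expansion fs ζ F m
  powerSum-expansion []                 _ _ _ F m m≤F = (λ _ → + m 0) , refl , λ _ → m≤F 0 (s≤s z≤n)
  powerSum-expansion ((p , zero) ∷ fs)  ((_ , ()) ∷ _) _ _ _ _ _
  powerSum-expansion ((p , suc a) ∷ fs) ((p-prime , _) ∷ pps) (p∉fs ∷ distinct) {ζ} ζ-prim F m m≤F =
    c′ , expansion , λ (k , l , i) → CoeffBound-- (length fs) (bound (toℕ k ℕ.* P ℕ.+ toℕ l) i) (bound (top l) i)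
    where
    instance
      p≢0 : ℕ.NonZero p
      p≢0 = prime⇒nonZero p-prime
    P q d′ : ℕ
    P  = p ℕ.^ a
    q  = p ℕ.* P
    d′ = prodPP fs
    ω η : C
    ω = pow ζ d′
    η = pow ζ q
    0<q : 0 < q
    0<q = ℕ.m^n>0 p (suc a)
    η-prim : IsPrimitiveRoot d′ η
    η-prim = primitiveRoot-pow q d′ 0<q ζ-prim
    w-prim : IsPrimitiveRoot p (pow ω P)
    w-prim = primitiveRoot-pow P p (ℕ.m^n>0 p a) (≡.subst (λ e → IsPrimitiveRoot e ω) (ℕ.*-comm p P)
      (primitiveRoot-pow d′ q (prodPP-positive fs pps) (≡.subst (λ e → IsPrimitiveRoot e ζ) (ℕ.*-comm q d′) ζ-prim)))
    q⊥d′ : Coprime q d′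
    q⊥d′ = Coprime.sym (coprime-^ʳ (Coprime.sym (prime-coprime-prodPP fs p-prime pps p∉fs)) (suc a))
    open CRTRegrouping K integral 1≉0 q d′ 0<q (prodPP-positive fs pps) ζ-prim q⊥d′ m
      using (crtMultiplicity; crtMultiplicity≤; powerSum-crt)
    IH : ∀ Y → Expansion fs η F (crtMultiplicity Y)
    IH Y = powerSum-expansion fs pps distinct η-prim F (crtMultiplicity Y) (λ Z _ → crtMultiplicity≤ m≤F Y Z)
    c : ℕ → Idx fs → ℤ
    c Y = proj₁ (IH Y)
    bound : ∀ Y i → CoeffBound (length fs) F (c Y i)
    bound Y = proj₂ (proj₂ (IH Y))
    top : Fin P → ℕ
    top l = (p ∸ 1) ℕ.* P ℕ.+ toℕ l
    c′ : Idx ((p , suc a) ∷ fs) → ℤ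
    c′ (k , l , i) = c (toℕ k ℕ.* P ℕ.+ toℕ l) i ℤ.- c (top l) i
    expansion : ∑ℕ[ r < q ℕ.* d′ ] (natK (m r) * pow ζ r) ≈ combB K ζ ((p , suc a) ∷ fs) c′
    expansion = begin
      ∑ℕ[ r < q ℕ.* d′ ] (natK (m r) * pow ζ r)
        ≈⟨ powerSum-crt ⟩
      ∑ℕ[ Y < q ] (pow ω Y * ∑ℕ[ Z < d′ ] (natK (crtMultiplicity Y Z) * pow η Z))
        ≈⟨ sum-cong-≋ {q} (λ Y → *-congˡ (proj₁ (proj₂ (IH (toℕ Y))))) ⟩
      ∑ℕ[ Y < q ] (pow ω Y * combB K η fs (c Y))
        ≈⟨ sum-eliminateTopBlock p P (ℕ.nonTrivial⇒n>1 p {{prime⇒nonTrivial p-prime}}) w-prim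
                                 (λ Y → combB K η fs (c Y)) ⟩
      ∑ℕ[ k < p ∸ 1 ] ∑ℕ[ l < P ]
        (pow ω (k ℕ.* P ℕ.+ l) * (combB K η fs (c (k ℕ.* P ℕ.+ l)) - combB K η fs (c ((p ∸ 1) ℕ.* P ℕ.+ l))))
        ≈⟨ sum-cong-≋ {p ∸ 1} (λ k → sum-cong-≋ {P} (λ l →
             *-congˡ (sym (combB-- η fs (c (toℕ k ℕ.* P ℕ.+ toℕ l)) (c (top l)))))) ⟩
      ∑[ k < p ∸ 1 ] ∑[ l < P ] (pow ω (toℕ k ℕ.* P ℕ.+ toℕ l) * combB K η fs (λ i → c′ (k , l , i)))
        ≈⟨ sym (combB-∷ ζ p a fs c′) ⟩
      combB K ζ ((p , suc a) ∷ fs) c′ ∎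

FinAbGroup⇒Group : ∀ {n} → FinAbGroup n → Group 0ℓ 0ℓ
FinAbGroup⇒Group G = record { isGroup = IsAbelianGroup.isGroup (FinAbGroup.isAbelianGroup G) }

module CyclicSubgroup {n} (G : FinAbGroup n) (h : Fin n) where
  open FinAbGroup G
  open IsAbelianGroup isAbelianGroup using (assoc; identityˡ; identityʳ)
  open GroupDefs G
  open import Algebra.Properties.Group (FinAbGroup⇒Group G) using (∙-cancelˡ)
  open ≡.≡-Reasoning

  gpow-+ : ∀ a b → gpow h (a ℕ.+ b) ≡ gpow h a ∙ gpow h b
  gpow-+ zero    b = ≡.sym (identityˡ _)
  gpow-+ (suc a) b = ≡.trans (≡.cong (h ∙_) (gpow-+ a b)) (≡.sym (assoc _ _ _))

  gpow-multiple : ∀ {d} → gpow h d ≡ ε → ∀ k → gpow h (k ℕ.* d) ≡ ε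
  gpow-multiple h^d≡ε zero    = ≡.refl
  gpow-multiple {d} h^d≡ε (suc k) = begin
    gpow h (d ℕ.+ k ℕ.* d)            ≡⟨ gpow-+ d (k ℕ.* d) ⟩
    gpow h d ∙ gpow h (k ℕ.* d)       ≡⟨ ≡.cong₂ _∙_ h^d≡ε (gpow-multiple h^d≡ε k) ⟩
    ε ∙ ε                             ≡⟨ identityˡ ε ⟩
    ε                                 ∎

  gpow-% : ∀ {d} .{{_ : ℕ.NonZero d}} → gpow h d ≡ ε → ∀ j → gpow h (j % d) ≡ gpow h j
  gpow-% {d} h^d≡ε j = begin
    gpow h (j % d)                           ≡⟨ identityʳ _ ⟨
    gpow h (j % d) ∙ ε                       ≡⟨ ≡.cong (gpow h (j % d) ∙_) (gpow-multiple h^d≡ε (j / d)) ⟨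
    gpow h (j % d) ∙ gpow h (j / d ℕ.* d)    ≡⟨ gpow-+ (j % d) _ ⟨
    gpow h (j % d ℕ.+ j / d ℕ.* d)           ≡⟨ ≡.cong (gpow h) (m≡m%n+[m/n]*n j d) ⟨
    gpow h j                                 ∎

  gpow-distinct : ∀ {d a b} → HasOrder h d → a < b → b < d → gpow h a ≢ gpow h b
  gpow-distinct {d} {a} {b} (_ , _ , minimal) a<b b<d h^a≡h^b =
    minimal (b ∸ a) (ℕ.m<n⇒0<n∸m a<b) (ℕ.≤-<-trans (ℕ.m∸n≤m b a) b<d)
      (≡.sym (∙-cancelˡ (gpow h a) ε (gpow h (b ∸ a)) (begin
        gpow h a ∙ ε                 ≡⟨ identityʳ _ ⟩
        gpow h a                     ≡⟨ h^a≡h^b ⟩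
        gpow h b                     ≡⟨ ≡.cong (gpow h) (ℕ.m+[n∸m]≡n (ℕ.<⇒≤ a<b)) ⟨
        gpow h (a ℕ.+ (b ∸ a))       ≡⟨ gpow-+ a (b ∸ a) ⟩
        gpow h a ∙ gpow h (b ∸ a)    ∎)))

  gpow-injective : ∀ {d a b} → HasOrder h d → a < d → b < d → gpow h a ≡ gpow h b → a ≡ b
  gpow-injective {a = a} {b} order a<d b<d h^a≡h^b with ℕ.<-cmp a b
  ... | tri< a<b _ _ = ⊥-elim (gpow-distinct order a<b b<d h^a≡h^b)
  ... | tri≈ _ a≡b _ = a≡b
  ... | tri> _ _ b<a = ⊥-elim (gpow-distinct order b<a a<d (≡.sym h^a≡h^b))

module CyclicCharacters {n} (G : FinAbGroup n) (h : Fin n) {d} (h-order : GroupDefs.HasOrder G h d)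
                        (K : CommutativeRing 0ℓ 0ℓ) (integral : RingDefs.IsIntegralDomain K)
                        (1≉0 : ¬ CommutativeRing._≈_ K (CommutativeRing.1# K) (CommutativeRing.0# K))
                        {ζ : CommutativeRing.Carrier K} (ζ-prim : RingDefs.IsPrimitiveRoot K d ζ)
                        (χ : Fin n → CommutativeRing.Carrier K) (χ-gen : CharDefs.IsGeneratorOfDual G K h χ) where
  open FinAbGroup G
  open IsAbelianGroup isAbelianGroup using (identityʳ)
  open GroupDefs G
  open CharDefs G K
  open CyclicSubgroup G h
  open CommutativeRing K renaming (Carrier to C)
  open RingDefs K
  open Powers K
  open RootsOfUnity K integral 1≉0
  open import Relation.Binary.Reasoning.Setoid setoid

  private
    0<d : 0 < d
    0<d = proj₁ h-order
    instance
      d≢0 : ℕ.NonZero d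
      d≢0 = ℕ.>-nonZero 0<d
    h^d≡ε : gpow h d ≡ ε
    h^d≡ε = proj₁ (proj₂ h-order)
    h∈⟨h⟩ : In⟨ h ⟩ h
    h∈⟨h⟩ = 1 , ≡.sym (identityʳ h)

  character-gpow : ∀ {ψ} → IsCharOf h ψ → ∀ j → ψ (gpow h j) ≈ pow (ψ h) j
  character-gpow (ψε≈1 , ψ-hom) zero    = ψε≈1
  character-gpow (ψε≈1 , ψ-hom) (suc j) =
    trans (ψ-hom h (gpow h j) h∈⟨h⟩ (j , ≡.refl)) (*-congˡ (character-gpow (ψε≈1 , ψ-hom) j))

  -- Some j < d with h^j = x, and 0 when x ∉ ⟨h⟩.
  exponentOf : Fin n → ℕ
  exponentOf x with Fin.any? (λ (j : Fin d) → gpow h (toℕ j) Fin.≟ x)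
  ... | yes (j , _) = toℕ j
  ... | no  _       = 0

  exponentOf-gpow : ∀ j → exponentOf (gpow h j) ≡ j % d
  exponentOf-gpow j with Fin.any? (λ (i : Fin d) → gpow h (toℕ i) Fin.≟ gpow h j)
  ... | yes (i , h^i≡h^j) =
    gpow-injective h-order (Fin.toℕ<n i) (m%n<n j d) (≡.trans h^i≡h^j (≡.sym (gpow-% h^d≡ε j)))
  ... | no  none          = ⊥-elim (none (Fin.fromℕ< (m%n<n j d) ,
                              ≡.trans (≡.cong (gpow h) (Fin.toℕ-fromℕ< (m%n<n j d))) (gpow-% h^d≡ε j)))

  ζ-character : Fin n → C
  ζ-character x = pow ζ (exponentOf x)

  ζ-character-gpow : ∀ j → ζ-character (gpow h j) ≈ pow ζ j
  ζ-character-gpow j = trans (reflexive (≡.cong (pow ζ) (exponentOf-gpow j))) (pow-% (proj₁ ζ-prim) j)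

  ζ-character-isChar : IsCharOf h ζ-character
  ζ-character-isChar = ζ-character-gpow 0 , hom
    where
    hom : ∀ x y → In⟨ h ⟩ x → In⟨ h ⟩ y → ζ-character (x ∙ y) ≈ ζ-character x * ζ-character y
    hom _ _ (a , ≡.refl) (b , ≡.refl) = begin
      ζ-character (gpow h a ∙ gpow h b)                ≡⟨ ≡.cong ζ-character (gpow-+ a b) ⟨
      ζ-character (gpow h (a ℕ.+ b))                   ≈⟨ ζ-character-gpow (a ℕ.+ b) ⟩
      pow ζ (a ℕ.+ b)                                  ≈⟨ pow-+ ζ a b ⟩
      pow ζ a * pow ζ b                                ≈⟨ *-cong (ζ-character-gpow a) (ζ-character-gpow b) ⟨
      ζ-character (gpow h a) * ζ-character (gpow h b)  ∎

  private
    ω : C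
    ω = χ h
    χ-gpow : ∀ j → χ (gpow h j) ≈ pow ω j
    χ-gpow = character-gpow (proj₁ χ-gen)
    ω^d≈1 : pow ω d ≈ 1#
    ω^d≈1 = trans (sym (χ-gpow d)) (trans (reflexive (≡.cong χ h^d≡ε)) (proj₁ (proj₁ χ-gen)))
    m : ℕ
    m = proj₁ (proj₂ χ-gen ζ-character ζ-character-isChar)
    ζ≈ω^m : ζ ≈ pow ω m
    ζ≈ω^m = begin
      ζ                   ≈⟨ *-identityʳ ζ ⟨
      pow ζ 1             ≈⟨ ζ-character-gpow 1 ⟨
      ζ-character (gpow h 1) ≡⟨ ≡.cong ζ-character (identityʳ h) ⟩
      ζ-character h       ≈⟨ proj₂ (proj₂ χ-gen ζ-character ζ-character-isChar) h h∈⟨h⟩ ⟩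
      pow ω m             ∎
    -- Since ζ = ω^m is primitive, so is ω, and ω is in turn a power of ζ.
    ω-prim : IsPrimitiveRoot d ω
    ω-prim = pow-primitive⇒primitive m ω^d≈1 (primitiveRoot-resp-≈ ζ≈ω^m ζ-prim)
    u : ℕ
    u = proj₁ (primitiveRoot-generates m 0<d ζ-prim ω^d≈1 ζ≈ω^m)
    ω≈ζ^u : ω ≈ pow ζ u
    ω≈ζ^u = proj₂ (primitiveRoot-generates m 0<d ζ-prim ω^d≈1 ζ≈ω^m)

  χ-gpow≈ζ^ : ∃ λ u → ∀ j → χ (gpow h j) ≈ pow ζ ((u ℕ.* j) % d)
  χ-gpow≈ζ^ = u , λ j → begin
    χ (gpow h j)          ≈⟨ χ-gpow j ⟩
    pow ω j               ≈⟨ pow-cong j ω≈ζ^u ⟩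
    pow (pow ζ u) j       ≈⟨ pow-* ζ u j ⟨
    pow ζ (u ℕ.* j)       ≈⟨ pow-% (proj₁ ζ-prim) (u ℕ.* j) ⟨
    pow ζ ((u ℕ.* j) % d) ∎

  χ-gpow-injective : ∀ a b → χ (gpow h a) ≈ χ (gpow h b) → gpow h a ≡ gpow h b
  χ-gpow-injective a b χa≈χb = ≡.trans (≡.sym (gpow-% h^d≡ε a))
    (≡.trans (≡.cong (gpow h) (primitiveRoot-pow-injective ω-prim (m%n<n a d) (m%n<n b d) ω^a%≈ω^b%))
             (gpow-% h^d≡ε b))
    where
    ω^a%≈ω^b% : pow ω (a % d) ≈ pow ω (b % d)
    ω^a%≈ω^b% = begin
      pow ω (a % d)   ≈⟨ pow-% ω^d≈1 a ⟩
      pow ω a         ≈⟨ χ-gpow a ⟨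
      χ (gpow h a)    ≈⟨ χa≈χb ⟩
      χ (gpow h b)    ≈⟨ χ-gpow b ⟩
      pow ω b         ≈⟨ pow-% ω^d≈1 b ⟨
      pow ω (b % d)   ∎

module EpimorphismFibres {n} (G : FinAbGroup n) (h : Fin n) {d} (h-order : GroupDefs.HasOrder G h d)
                         (ρ : Fin n → Fin n) (ρ-epi : GroupDefs.IsEpiOnto G h ρ) where
  open FinAbGroup G
  open IsAbelianGroup isAbelianGroup using (assoc; identityˡ; identityʳ; inverseˡ; inverseʳ)
  open GroupDefs G
  open CyclicSubgroup G h
  open Counting
  open import Algebra.Properties.Group (FinAbGroup⇒Group G) using (∙-cancelʳ)
  open import Data.Fin.Permutation using (Permutation′; permutation)

  fibreSize : Fin n → ℕ
  fibreSize y = ∑[ x < n ] when (ρ x Fin.≟ y) 1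

  kernelSize : ℕ
  kernelSize = fibreSize ε

  fibreSize-image : ∀ x₀ → fibreSize (ρ x₀) ≡ kernelSize
  fibreSize-image x₀ = ≡.trans (∑-permute (λ x → when (ρ x Fin.≟ ρ x₀) 1) translation)
    (sum-cong-≋ {n} (λ x → when-cong (ρ (x ∙ x₀) Fin.≟ ρ x₀) (ρ x Fin.≟ ε) (to x) (from x)))
    where
    translation : Permutation′ n
    translation = permutation (λ x → x ∙ x₀) (λ x → x ∙ (x₀ ⁻¹))
      (λ x → ≡.trans (assoc _ _ _) (≡.trans (≡.cong (x ∙_) (inverseˡ x₀)) (identityʳ x)))
      (λ x → ≡.trans (assoc _ _ _) (≡.trans (≡.cong (x ∙_) (inverseʳ x₀)) (identityʳ x)))
    to : ∀ x → ρ (x ∙ x₀) ≡ ρ x₀ → ρ x ≡ ε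
    to x ρxx₀≡ρx₀ = ∙-cancelʳ (ρ x₀) (ρ x) ε
      (≡.trans (≡.sym (proj₁ ρ-epi x x₀)) (≡.trans ρxx₀≡ρx₀ (≡.sym (identityˡ (ρ x₀)))))
    from : ∀ x → ρ x ≡ ε → ρ (x ∙ x₀) ≡ ρ x₀
    from x ρx≡ε = ≡.trans (proj₁ ρ-epi x x₀) (≡.trans (≡.cong (_∙ ρ x₀) ρx≡ε) (identityˡ (ρ x₀)))

  kernelSize*d≤n : kernelSize ℕ.* d ≤ n
  kernelSize*d≤n = begin
    kernelSize ℕ.* d                              ≡⟨ ℕ.*-comm kernelSize d ⟩
    d ℕ.* kernelSize                              ≡⟨ sum-const d kernelSize ⟨
    ∑[ j < d ] kernelSize                         ≡⟨ sum-cong-≋ {d} (λ j → fibreSize-gpow (toℕ j)) ⟨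
    ∑[ j < d ] fibreSize (gpow h (toℕ j))         ≡⟨ ∑-comm {d} {n} (λ j x → when (ρ x Fin.≟ gpow h (toℕ j)) 1) ⟩
    ∑[ x < n ] ∑[ j < d ] when (ρ x Fin.≟ gpow h (toℕ j)) 1
      ≤⟨ sum-mono-≤ {n} (λ x → sum-≤-singleSupport _ (single x) (λ j → when-≤ (ρ x Fin.≟ gpow h (toℕ j)) 1)) ⟩
    ∑[ x < n ] 1                                  ≡⟨ sum-const n 1 ⟩
    n ℕ.* 1                                       ≡⟨ ℕ.*-identityʳ n ⟩
    n                                             ∎
    where
    open ℕ.≤-Reasoning
    fibreSize-gpow : ∀ j → fibreSize (gpow h j) ≡ kernelSize
    fibreSize-gpow j with proj₂ (proj₂ ρ-epi) (gpow h j) (j , ≡.refl)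
    ... | x , ρx≡h^j = ≡.trans (≡.cong fibreSize (≡.sym ρx≡h^j)) (fibreSize-image x)
    single : ∀ x (j j′ : Fin d) → when (ρ x Fin.≟ gpow h (toℕ j)) 1 ≢ 0 →
             when (ρ x Fin.≟ gpow h (toℕ j′)) 1 ≢ 0 → j ≡ j′
    single x j j′ s≢0 s′≢0 = Fin.toℕ-injective (gpow-injective h-order (Fin.toℕ<n j) (Fin.toℕ<n j′)
      (≡.trans (≡.sym (proj₁ (when-≢0 (ρ x Fin.≟ gpow h (toℕ j)) 1 s≢0)))
               (proj₁ (when-≢0 (ρ x Fin.≟ gpow h (toℕ j′)) 1 s′≢0))))

module CharacterImage {n} (G : FinAbGroup n) (h : Fin n) {d} (h-order : GroupDefs.HasOrder G h d)
                      (ρ : Fin n → Fin n) (ρ-epi : GroupDefs.IsEpiOnto G h ρ) (D : Subset n)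
                      (K : CommutativeRing 0ℓ 0ℓ) (integral : RingDefs.IsIntegralDomain K)
                      (1≉0 : ¬ CommutativeRing._≈_ K (CommutativeRing.1# K) (CommutativeRing.0# K))
                      {ζ : CommutativeRing.Carrier K} (ζ-prim : RingDefs.IsPrimitiveRoot K d ζ)
                      (χ : Fin n → CommutativeRing.Carrier K) (χ-gen : CharDefs.IsGeneratorOfDual G K h χ) where
  open GroupDefs G
  open CharDefs G K
  open CommutativeRing K renaming (Carrier to C)
  open RingDefs K
  open RingSums K
  open CyclicCharacters G h h-order K integral 1≉0 ζ-prim χ χ-gen using (χ-gpow≈ζ^; χ-gpow-injective)
  open EpimorphismFibres G h h-order ρ ρ-epi using (kernelSize; fibreSize-image)
  open import Relation.Binary.Reasoning.Setoid setoid

  private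
    instance
      d≢0 : ℕ.NonZero d
      d≢0 = ℕ.>-nonZero (proj₁ h-order)
    j : Fin n → ℕ
    j x = proj₁ (proj₁ (proj₂ ρ-epi) x)
    ρ≡h^j : ∀ x → ρ x ≡ gpow h (j x)
    ρ≡h^j x = proj₂ (proj₁ (proj₂ ρ-epi) x)
    u : ℕ
    u = proj₁ χ-gpow≈ζ^

  key : Fin n → ℕ
  key x = (u ℕ.* j x) % d

  χρ≈ζ^key : ∀ x → χ (ρ x) ≈ pow ζ (key x)
  χρ≈ζ^key x = trans (reflexive (≡.cong χ (ρ≡h^j x))) (proj₂ χ-gpow≈ζ^ (j x))

  key-fibre : ∀ x x′ → key x ≡ key x′ → ρ x ≡ ρ x′
  key-fibre x x′ key≡ = ≡.trans (ρ≡h^j x) (≡.trans (χ-gpow-injective (j x) (j x′) χh^j≈χh^j′) (≡.sym (ρ≡h^j x′)))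
    where
    χh^j≈χh^j′ : χ (gpow h (j x)) ≈ χ (gpow h (j x′))
    χh^j≈χh^j′ = trans (proj₂ χ-gpow≈ζ^ (j x))
      (trans (reflexive (≡.cong (pow ζ) key≡)) (sym (proj₂ χ-gpow≈ζ^ (j x′))))

  multiplicity : ℕ → ℕ
  multiplicity = Counting.fibreWeight key (λ x → Counting.when (x ∈? D) 1)

  multiplicity≤kernelSize : ∀ r → multiplicity r ≤ kernelSize
  multiplicity≤kernelSize r with Fin.any? (λ x → key x ℕ.≟ r)
  ... | yes (x₀ , key₀≡r) = ℕ.≤-trans (Counting.sum-mono-≤ {n} inFibre) (ℕ.≤-reflexive (fibreSize-image x₀))
    where
    inFibre : ∀ x → Counting.when (key x ℕ.≟ r) (Counting.when (x ∈? D) 1) ≤ Counting.when (ρ x Fin.≟ ρ x₀) 1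
    inFibre x = Counting.when-mono (key x ℕ.≟ r) (ρ x Fin.≟ ρ x₀)
      (λ key≡r → key-fibre x x₀ (≡.trans key≡r (≡.sym key₀≡r))) (Counting.when-≤ (x ∈? D) 1)
  ... | no  empty = ℕ.≤-trans (ℕ.≤-reflexive (Counting.sum-zero {n} vanish)) z≤n
    where
    vanish : ∀ x → Counting.when (key x ℕ.≟ r) (Counting.when (x ∈? D) 1) ≡ 0
    vanish x = Counting.when-¬ (key x ℕ.≟ r) (λ key≡r → empty (x , key≡r))

  -- The summand of charOfImage is local to its where-block; unification recovers it.
  private
    summandOf : ∀ {N} (v : C) {t : Fin N → C} → v ≡ sumK (map t (allFin N)) → Fin N → C
    summandOf _ {t} _ = t
    image-summand : ∀ x → summandOf {n} (charOfImage χ ρ D) ≡.refl x ≈ when (x ∈? D) (χ (ρ x))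
    image-summand x with x ∈? D
    ... | yes _ = refl
    ... | no  _ = refl

  charOfImage≈powerSum : charOfImage χ ρ D ≈ ∑ℕ[ r < d ] (natK (multiplicity r) * pow ζ r)
  charOfImage≈powerSum = begin
    charOfImage χ ρ D
      ≈⟨ sumK-map-allFin {n} (summandOf {n} (charOfImage χ ρ D) ≡.refl) ⟩
    ∑[ x < n ] summandOf {n} (charOfImage χ ρ D) ≡.refl x
      ≈⟨ sum-cong-≋ {n} (λ x → trans (image-summand x) (weighted x)) ⟩
    ∑[ x < n ] (natK (Counting.when (x ∈? D) 1) * pow ζ (key x))
      ≈⟨ sum-collect d key (λ x → m%n<n (u ℕ.* j x) d) (λ x → Counting.when (x ∈? D) 1) (pow ζ) ⟩
    ∑ℕ[ r < d ] (natK (multiplicity r) * pow ζ r)       ∎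
    where
    weighted : ∀ x → when (x ∈? D) (χ (ρ x)) ≈ natK (Counting.when (x ∈? D) 1) * pow ζ (key x)
    weighted x with does (x ∈? D)
    ... | Bool.true  = trans (χρ≈ζ^key x) (sym (trans (*-congʳ (+-identityʳ 1#)) (*-identityˡ _)))
    ... | Bool.false = sym (zeroˡ _)

open import Data.Nat using (_*_; _^_)

corollary3p3 :
    (n : ℕ) (G : FinAbGroup n) (h : Fin n) (d : ℕ) →
    GroupDefs.HasOrder G h d →
    (ρ : Fin n → Fin n) → GroupDefs.IsEpiOnto G h ρ →
    (D : Subset n) →
    (fs : List (ℕ × ℕ)) → IsPrimeFactorisation d fs →
    (K : CommutativeRing 0ℓ 0ℓ) → RingDefs.IsIntegralDomain K → RingDefs.CharZero K →
    (ζ : CommutativeRing.Carrier K) → RingDefs.IsPrimitiveRoot K d ζ →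
    (χ : Fin n → CommutativeRing.Carrier K) → CharDefs.IsGeneratorOfDual G K h χ →
    Σ (Idx fs → ℤ) λ c →
      CommutativeRing._≈_ K (CharDefs.charOfImage G K χ ρ D) (combB K ζ fs c) ×
      (∀ i → ∣ c i ∣ * d ≤ 2 ^ (length fs ∸ 1) * n)
corollary3p3 n G h .(prodPP fs) h-order ρ ρ-epi D fs (pps , distinct , ≡.refl) K integral char0 ζ ζ-prim χ χ-gen =
  proj₁ expansion ,
  CommutativeRing.trans K charOfImage≈powerSum (proj₁ (proj₂ expansion)) ,
  λ i → CoeffBound-scaled (length fs) (proj₂ (proj₂ expansion) i) kernelSize*d≤n
  where
  1≉0 : ¬ CommutativeRing._≈_ K (CommutativeRing.1# K) (CommutativeRing.0# K)
  1≉0 1≈0 = char0 0 (CommutativeRing.trans K (CommutativeRing.+-identityʳ K _) 1≈0)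
  open CharacterImage G h h-order ρ ρ-epi D K integral 1≉0 ζ-prim χ χ-gen
    using (multiplicity; multiplicity≤kernelSize; charOfImage≈powerSum)
  open EpimorphismFibres G h h-order ρ ρ-epi using (kernelSize; kernelSize*d≤n)
  open PowerSumExpansion K integral 1≉0 using (Expansion; powerSum-expansion)
  expansion : Expansion fs ζ kernelSize multiplicity
  expansion = powerSum-expansion fs pps distinct ζ-prim kernelSize multiplicity (λ r _ → multiplicity≤kernelSize r)
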